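{- Let $q$ be a prime power, $m\ge1$, and let $t$ be an integer with $1\le t\le m$. Let $I_{m,t}=\langle\{\sigma_t,\sigma_{t+1},\dots,\sigma_m\}\cup E_q[Y]\rangle\subseteq\mathbb{F}_q[y_1,\dots,y_m]$. Then, with respect to any admissible term order, the reduced Gröbner basis $G(I_{m,t})$ of $I_{m,t}$ is $$G(I_{m,t})=E_q[Y]\cup\mathcal{M}_{m,t}\quad\text{if } t\ge 2,\qquad G(I_{m,t})=\{y_1,\dots,y_m\}\quad\text{if } t=1.$$
   Context: $\mathbb{F}_q$ is the finite field with $q$ elements. $E_q[Y]=\{y_1^q-y_1,\dots,y_m^q-y_m\}$. For $1\le t\le m$, $\mathcal{M}_{m,t}=\{y_{h_1}\cdots y_{h_t}\mid 1\le h_1<\dots<h_t\le m\}$. $\sigma_i$ denotes the $i$-th elementary symmetric polynomial in $y_1,\dots,y_m$. -}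

module Defs where

open import Level using (Level; _⊔_) renaming (suc to lsuc)
open import Data.Nat as ℕ using (ℕ; zero; suc)
import Data.Nat.Properties as ℕP
open import Data.Fin using (Fin)
open import Data.Vec as Vec using (Vec; []; _∷_; replicate; zipWith; _[_]≔_)
open import Data.Vec.Properties using (≡-dec)
open import Data.Vec.Relation.Binary.Pointwise.Inductive using (Pointwise)
open import Data.List as List using (List; []; _∷_; _++_; map; concatMap; upTo; length; lookup; allFin)
open import Data.Product using (Σ; _×_; _,_; proj₁; proj₂; ∃)
open import Data.Sum using (_⊎_)
open import Relation.Nullary using (¬_; yes; no)
open import Relation.Binary.PropositionalEquality using (_≡_; _≢_)
import Relation.Binary.PropositionalEquality as ≡
open import Relation.Binary using (Rel; IsStrictTotalOrder)
open import Function.Bundles using (Inverse)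
open import Algebra.Bundles using (CommutativeRing)

record FiniteField (c ℓ : Level) : Set (lsuc (c ⊔ ℓ)) where
  field
    commutativeRing : CommutativeRing c ℓ
  open CommutativeRing commutativeRing public
  field
    0≉1      : ¬ (0# ≈ 1#)
    inverse  : ∀ x → ¬ (x ≈ 0#) → Σ Carrier λ y → x * y ≈ 1#
    size     : ℕ
    enumerate : Inverse setoid (≡.setoid (Fin size))

Monomial : ℕ → Set
Monomial m = Vec ℕ m

_·ₘ_ : ∀ {m} → Monomial m → Monomial m → Monomial m
_·ₘ_ = zipWith ℕ._+_

oneₘ : ∀ {m} → Monomial m
oneₘ {m} = replicate m 0

varPow : ∀ {m} → Fin m → ℕ → Monomial m
varPow {m} i e = replicate m 0 [ i ]≔ e

_∣ₘ_ : ∀ {m} → Monomial m → Monomial m → Set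
_∣ₘ_ = Pointwise ℕ._≤_

record TermOrder (m : ℕ) : Set₁ where
  field
    _<_                : Rel (Monomial m) Level.zero
    isStrictTotalOrder : IsStrictTotalOrder _≡_ _<_
    mult-compatible    : ∀ α β γ → α < β → (α ·ₘ γ) < (β ·ₘ γ)
    one-least          : ∀ α → α ≢ oneₘ → oneₘ < α

-- Polynomials over a finite field, represented as finite lists of terms
-- (coefficient, monomial); two representations denote the same
-- polynomial iff all their coefficients agree.

module Polynomials {c ℓ} (F : FiniteField c ℓ) (m : ℕ) where
  open FiniteField F

  Poly : Set c
  Poly = List (Carrier × Monomial m)

  coeff : Poly → Monomial m → Carrier
  coeff []             α = 0#
  coeff ((a , β) ∷ p)  α with ≡-dec ℕP._≟_ β α
  ... | yes _ = a + coeff p α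
  ... | no  _ = coeff p α

  _≈P_ : Poly → Poly → Set ℓ
  p ≈P r = ∀ α → coeff p α ≈ coeff r α

  0P : Poly
  0P = []

  _+P_ : Poly → Poly → Poly
  _+P_ = _++_

  -P_ : Poly → Poly
  -P_ = map (λ { (a , α) → (- a , α) })

  _*P_ : Poly → Poly → Poly
  p *P r = concatMap (λ { (a , α) → map (λ { (b , β) → (a * b , α ·ₘ β) }) r }) p

  mono : Monomial m → Poly
  mono α = (1# , α) ∷ []

  var : Fin m → Poly
  var i = mono (varPow i 1)

  sumFin : ∀ {n} → (Fin n → Poly) → Poly
  sumFin {n} f = List.foldr _+P_ 0P (map f (allFin n))

  InIdeal : List Poly → Poly → Set (c ⊔ ℓ)
  InIdeal gens f =
    Σ (Fin (length gens) → Poly) λ h → f ≈P sumFin (λ i → h i *P lookup gens i)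

  InSupport : Poly → Monomial m → Set ℓ
  InSupport p α = ¬ (coeff p α ≈ 0#)

  module _ (ord : TermOrder m) where
    open TermOrder ord

    IsLM : Poly → Monomial m → Set ℓ
    IsLM p α = InSupport p α × (∀ β → InSupport p β → β ≡ α ⊎ β < α)

    record IsReducedGB (gens : List Poly) (G : List Poly) : Set (c ⊔ ℓ) where
      field
        inIdeal   : ∀ i → InIdeal gens (lookup G i)
        nonzero   : ∀ i → ∃ λ α → IsLM (lookup G i) α
        monic     : ∀ i α → IsLM (lookup G i) α → coeff (lookup G i) α ≈ 1#
        -- ⟨LT(I)⟩ = ⟨LT(G)⟩
        leading   : ∀ f → InIdeal gens f → ∀ α → IsLM f α →
                    Σ (Fin (length G)) λ i → Σ (Monomial m) λ β →
                      IsLM (lookup G i) β × β ∣ₘ α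
        reduced   : ∀ i j → i ≢ j → ∀ α β → InSupport (lookup G i) α →
                    IsLM (lookup G j) β → ¬ (β ∣ₘ α)

sqfree : (m k : ℕ) → List (Monomial m)
sqfree zero    zero    = [] ∷ []
sqfree zero    (suc k) = []
sqfree (suc m) zero    = map (0 ∷_) (sqfree m zero)
sqfree (suc m) (suc k) = map (1 ∷_) (sqfree m k) ++ map (0 ∷_) (sqfree m (suc k))

module Specific {c ℓ} (F : FiniteField c ℓ) (m : ℕ) where
  open FiniteField F
  open Polynomials F m

  q : ℕ
  q = size

  σ : ℕ → Poly
  σ k = map (λ α → (1# , α)) (sqfree m k)

  Eq : List Poly
  Eq = map (λ i → mono (varPow i q) +P (-P var i)) (allFin m)

  M : ℕ → List Poly
  M t = map mono (sqfree m t)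

  Igens : ℕ → List Poly
  Igens t = map (λ j → σ (t ℕ.+ j)) (upTo (suc m ℕ.∸ t)) ++ Eq

  Vars : List Poly
  Vars = map var (allFin m)

module Submission where

-- The proof has two halves; only q ≥ 2 is used about the field.
--
-- (1) Every square-free monomial y^S of degree ≥ t lies in I_{m,t}
--     (Generators.sqfree∈I).  Put e_j = 1 - y_j^(q-1), so that y_j e_j ∈ I.
--     Multiplying σ_{deg S} by Π_{j ∉ S} e_j kills every other square-free
--     term of that degree, hence y^S Π_{j ∉ S} e_j ∈ I.  The factors e_j are
--     then removed one at a time via  y^S P = y^S e_j P + y_j^(q-2) y^(S+e_j) P.
-- (2) Every leading monomial α of I_{m,t} has an exponent ≥ q or involves at
--     least t variables (SeparatingFunctional.leading-monomials).  Otherwise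
--     pairing with  β ↦ [β ≡ α modulo y_j^q = y_j]  is a linear functional
--     that vanishes on I_{m,t} (on multiples of σ_r, r ≥ t, for degree reasons
--     and on multiples of y_j^q - y_j by construction) but returns the nonzero
--     leading coefficient at α.
--
-- By (1) and (2) the y_j^q together with the square-free monomials of degree t
-- (for t = 1: the variables) generate the leading-term ideal; monicity,
-- interreducedness and distinctness are checked directly (ReducedBasis).

open import Defs
open import Level using (Level; _⊔_)
open import Data.Nat as ℕ using (ℕ; zero; suc; _≤_; _≤?_; z≤n; s≤s)
import Data.Nat.Properties as ℕP
import Data.Nat.DivMod as DivMod
open import Data.Fin as Fin using (Fin)
open import Data.Fin.Properties using (suc-injective; any?)
open import Data.Vec as Vec using ([]; _∷_; lookup; replicate; _[_]≔_)
open import Data.Vec.Properties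
  using (≡-dec; zipWith-comm; zipWith-assoc; zipWith-identityˡ; zipWith-identityʳ; lookup∘update;
         lookup∘update′; lookup-replicate; []≔-idempotent; []≔-lookup; map-[]≔; ∷-injectiveʳ)
import Data.Vec.Relation.Binary.Pointwise.Inductive as Pointwise
open import Data.Vec.Relation.Binary.Pointwise.Inductive using ([]; _∷_)
open import Data.List as List using (List; []; _∷_; _++_; length; upTo; allFin)
import Data.List.Properties as ListP
open import Data.List.Membership.Propositional using (_∈_)
import Data.List.Membership.Propositional.Properties as ∈
open import Data.List.Relation.Unary.Any as Any using (here; there)
import Data.List.Relation.Unary.Any.Properties as AnyP
import Data.List.Relation.Unary.All as All
open import Data.List.Relation.Unary.AllPairs as AllPairs using (_∷_)
open import Data.List.Relation.Unary.Unique.Propositional using (Unique)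
import Data.List.Relation.Unary.Unique.Propositional.Properties as Unique
open import Data.Product using (Σ; _×_; _,_; proj₁; proj₂)
open import Data.Sum using (_⊎_; inj₁; inj₂)
open import Data.Empty using (⊥; ⊥-elim)
open import Relation.Nullary using (yes; no; Dec; contradiction)
open import Relation.Binary.PropositionalEquality as ≡ using (_≡_; _≢_)
open import Relation.Binary.Structures using (IsStrictTotalOrder)
open import Algebra.Bundles using (CommutativeRing)
open import Algebra.Structures using (IsCommutativeRing)
open import Function.Bundles using (Inverse; Injection)
open import Function.Properties.Inverse using (Inverse⇒Injection)


-- Exponent vectors: monomials y^α ↔ α ∈ ℕ^k.
module Exponents where
  open import Data.Nat using (_+_; _<_)
  open ≡ using (refl; sym; trans; cong; cong₂; subst; subst₂; module ≡-Reasoning)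

  ·ₘ-comm : ∀ {k} (α β : Monomial k) → α ·ₘ β ≡ β ·ₘ α
  ·ₘ-comm = zipWith-comm ℕP.+-comm

  ·ₘ-assoc : ∀ {k} (α β γ : Monomial k) → (α ·ₘ β) ·ₘ γ ≡ α ·ₘ (β ·ₘ γ)
  ·ₘ-assoc = zipWith-assoc ℕP.+-assoc

  ·ₘ-identityˡ : ∀ {k} (α : Monomial k) → oneₘ ·ₘ α ≡ α
  ·ₘ-identityˡ = zipWith-identityˡ ℕP.+-identityˡ

  ·ₘ-identityʳ : ∀ {k} (α : Monomial k) → α ·ₘ oneₘ ≡ α
  ·ₘ-identityʳ = zipWith-identityʳ ℕP.+-identityʳ

  ∣ₘ⇒factor : ∀ {k} {β α : Monomial k} → β ∣ₘ α → Σ (Monomial k) λ γ → α ≡ β ·ₘ γ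
  ∣ₘ⇒factor [] = [] , refl
  ∣ₘ⇒factor {β = b ∷ β} {a ∷ α} (b≤a ∷ β∣α) =
    let γ , α≡βγ = ∣ₘ⇒factor β∣α in
    (a ℕ.∸ b) ∷ γ , cong₂ _∷_ (sym (ℕP.m+[n∸m]≡n b≤a)) α≡βγ

  factor-∣ₘ : ∀ {k} (β γ : Monomial k) → γ ∣ₘ (β ·ₘ γ)
  factor-∣ₘ []      []      = []
  factor-∣ₘ (b ∷ β) (c ∷ γ) = ℕP.m≤n+m c b ∷ factor-∣ₘ β γ

  suppSize : ∀ {k} → Monomial k → ℕ
  suppSize []          = 0
  suppSize (zero  ∷ α) = suppSize α
  suppSize (suc _ ∷ α) = suc (suppSize α)

  suppSize≤ : ∀ {k} (α : Monomial k) → suppSize α ≤ k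
  suppSize≤ []          = z≤n
  suppSize≤ (zero  ∷ α) = ℕP.m≤n⇒m≤1+n (suppSize≤ α)
  suppSize≤ (suc _ ∷ α) = s≤s (suppSize≤ α)

  suppSize-mono : ∀ {k} {β α : Monomial k} → β ∣ₘ α → suppSize β ≤ suppSize α
  suppSize-mono [] = z≤n
  suppSize-mono {β = zero  ∷ β} {zero  ∷ α} (_ ∷ β∣α) = suppSize-mono β∣α
  suppSize-mono {β = zero  ∷ β} {suc _ ∷ α} (_ ∷ β∣α) = ℕP.m≤n⇒m≤1+n (suppSize-mono β∣α)
  suppSize-mono {β = suc _ ∷ β} {suc _ ∷ α} (_ ∷ β∣α) = s≤s (suppSize-mono β∣α)

  suppSize-oneₘ : ∀ k → suppSize (oneₘ {k}) ≡ 0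
  suppSize-oneₘ zero    = refl
  suppSize-oneₘ (suc k) = suppSize-oneₘ k

  positiveEntry : ∀ {k} (α : Monomial k) → 1 ≤ suppSize α → Σ (Fin k) λ j → 1 ≤ lookup α j
  positiveEntry (zero  ∷ α) 1≤ = let j , pos = positiveEntry α 1≤ in Fin.suc j , pos
  positiveEntry (suc _ ∷ α) _  = Fin.zero , s≤s z≤n

  lookup-varPow : ∀ {k} (j : Fin k) a → lookup (varPow j a) j ≡ a
  lookup-varPow j a = lookup∘update j (replicate _ 0) a

  lookup-varPow′ : ∀ {k} {i j : Fin k} a → i ≢ j → lookup (varPow j a) i ≡ 0
  lookup-varPow′ {i = i} a i≢j = trans (lookup∘update′ i≢j (replicate _ 0) a) (lookup-replicate i 0)

  ·ₘ-varPow : ∀ {k} (α : Monomial k) j a → α ·ₘ varPow j a ≡ α [ j ]≔ (lookup α j + a)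
  ·ₘ-varPow (b ∷ α) Fin.zero    a = cong ((b + a) ∷_) (·ₘ-identityʳ α)
  ·ₘ-varPow (b ∷ α) (Fin.suc j) a = cong₂ _∷_ (ℕP.+-identityʳ b) (·ₘ-varPow α j a)

  varPow-+ : ∀ {k} (j : Fin k) a b → varPow j a ·ₘ varPow j b ≡ varPow j (a + b)
  varPow-+ j a b = begin
    varPow j a ·ₘ varPow j b                            ≡⟨ ·ₘ-varPow (varPow j a) j b ⟩
    varPow j a [ j ]≔ (lookup (varPow j a) j + b)       ≡⟨ cong (λ e → varPow j a [ j ]≔ (e + b)) (lookup-varPow j a) ⟩
    varPow j a [ j ]≔ (a + b)                           ≡⟨ []≔-idempotent (replicate _ 0) j ⟩
    varPow j (a + b)                                    ∎
    where open ≡-Reasoning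

  varPow-factor : ∀ {k} (α : Monomial k) j → lookup α j ≡ 1 → α ≡ varPow j 1 ·ₘ (α [ j ]≔ 0)
  varPow-factor α j αj≡1 = sym (begin
    varPow j 1 ·ₘ (α [ j ]≔ 0)                 ≡⟨ ·ₘ-comm (varPow j 1) _ ⟩
    (α [ j ]≔ 0) ·ₘ varPow j 1                 ≡⟨ ·ₘ-varPow _ j 1 ⟩
    (α [ j ]≔ 0) [ j ]≔ (lookup (α [ j ]≔ 0) j + 1) ≡⟨ cong (λ e → (α [ j ]≔ 0) [ j ]≔ (e + 1)) (lookup∘update j α 0) ⟩
    (α [ j ]≔ 0) [ j ]≔ 1                      ≡⟨ []≔-idempotent α j ⟩
    α [ j ]≔ 1                                 ≡⟨ cong (α [ j ]≔_) (sym αj≡1) ⟩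
    α [ j ]≔ lookup α j                        ≡⟨ []≔-lookup α j ⟩
    α                                          ∎)
    where open ≡-Reasoning

  shift-varPow : ∀ {k} (α : Monomial k) j n → lookup α j ≡ 0 →
                 α ·ₘ varPow j (suc n) ≡ (α [ j ]≔ 1) ·ₘ varPow j n
  shift-varPow α j n αj≡0 = begin
    α ·ₘ varPow j (suc n)                        ≡⟨ ·ₘ-varPow α j (suc n) ⟩
    α [ j ]≔ (lookup α j + suc n)                ≡⟨ cong (λ e → α [ j ]≔ (e + suc n)) αj≡0 ⟩
    α [ j ]≔ suc n                               ≡⟨ sym ([]≔-idempotent α j) ⟩
    (α [ j ]≔ 1) [ j ]≔ (1 + n)                  ≡⟨ cong (λ e → (α [ j ]≔ 1) [ j ]≔ (e + n)) (sym (lookup∘update j α 1)) ⟩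
    (α [ j ]≔ 1) [ j ]≔ (lookup (α [ j ]≔ 1) j + n) ≡⟨ sym (·ₘ-varPow (α [ j ]≔ 1) j n) ⟩
    (α [ j ]≔ 1) ·ₘ varPow j n                   ∎
    where open ≡-Reasoning

  varPow-∣ₘ : ∀ {k} (α : Monomial k) j a → a ≤ lookup α j → varPow j a ∣ₘ α
  varPow-∣ₘ (b ∷ α) Fin.zero    a a≤b = a≤b ∷ oneₘ-∣ₘ α
    where
    oneₘ-∣ₘ : ∀ {k} (α : Monomial k) → oneₘ ∣ₘ α
    oneₘ-∣ₘ []      = []
    oneₘ-∣ₘ (_ ∷ α) = z≤n ∷ oneₘ-∣ₘ α
  varPow-∣ₘ (b ∷ α) (Fin.suc j) a a≤αj = z≤n ∷ varPow-∣ₘ α j a a≤αj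

  varPow-∣ₘ-varPow : ∀ {k} (i j : Fin k) a b → 1 ≤ a → varPow i a ∣ₘ varPow j b → i ≡ j
  varPow-∣ₘ-varPow i j a b 1≤a yᵢ∣yⱼ with i Fin.≟ j
  ... | yes i≡j = i≡j
  ... | no  i≢j = contradiction
    (subst₂ _≤_ (lookup-varPow i a) (lookup-varPow′ b i≢j) (Pointwise.lookup yᵢ∣yⱼ i))
    (ℕP.<⇒≱ 1≤a)

  varPow-injective : ∀ {k} (i j : Fin k) a → 1 ≤ a → varPow i a ≡ varPow j a → i ≡ j
  varPow-injective i j a 1≤a yᵢ≡yⱼ =
    varPow-∣ₘ-varPow i j a a 1≤a (subst (varPow i a ∣ₘ_) yᵢ≡yⱼ (Pointwise.refl ℕP.≤-refl))

  suppSize-varPow : ∀ {k} (j : Fin k) a → suppSize (varPow j a) ≤ 1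
  suppSize-varPow {suc k} Fin.zero zero    = ℕP.≤-trans (ℕP.≤-reflexive (suppSize-oneₘ k)) z≤n
  suppSize-varPow {suc k} Fin.zero (suc _) = s≤s (ℕP.≤-reflexive (suppSize-oneₘ k))
  suppSize-varPow (Fin.suc j) a = suppSize-varPow j a

  suppSize-var : ∀ {k} (j : Fin k) → suppSize (varPow j 1) ≡ 1
  suppSize-var {suc k} Fin.zero    = cong suc (suppSize-oneₘ k)
  suppSize-var         (Fin.suc j) = suppSize-var j

  data SquareFree : ∀ {k} → Monomial k → Set where
    sf[] : SquareFree []
    sf0  : ∀ {k} {α : Monomial k} → SquareFree α → SquareFree (0 ∷ α)
    sf1  : ∀ {k} {α : Monomial k} → SquareFree α → SquareFree (1 ∷ α)

  SquareFree-var : ∀ {k} (j : Fin k) → SquareFree (varPow j 1)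
  SquareFree-var {suc k} Fin.zero    = sf1 oneₘ-SquareFree
    where
    oneₘ-SquareFree : ∀ {k} → SquareFree (oneₘ {k})
    oneₘ-SquareFree {zero}  = sf[]
    oneₘ-SquareFree {suc k} = sf0 oneₘ-SquareFree
  SquareFree-var         (Fin.suc j) = sf0 (SquareFree-var j)

  SquareFree-entry≤1 : ∀ {k} {α : Monomial k} → SquareFree α → ∀ j → lookup α j ≤ 1
  SquareFree-entry≤1 (sf0 _)  Fin.zero    = z≤n
  SquareFree-entry≤1 (sf1 _)  Fin.zero    = s≤s z≤n
  SquareFree-entry≤1 (sf0 sf) (Fin.suc j) = SquareFree-entry≤1 sf j
  SquareFree-entry≤1 (sf1 sf) (Fin.suc j) = SquareFree-entry≤1 sf j

  SquareFree-adjoin : ∀ {k} {α : Monomial k} j → SquareFree α → SquareFree (α [ j ]≔ 1)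
  SquareFree-adjoin Fin.zero    (sf0 sf) = sf1 sf
  SquareFree-adjoin Fin.zero    (sf1 sf) = sf1 sf
  SquareFree-adjoin (Fin.suc j) (sf0 sf) = sf0 (SquareFree-adjoin j sf)
  SquareFree-adjoin (Fin.suc j) (sf1 sf) = sf1 (SquareFree-adjoin j sf)

  suppSize-adjoin : ∀ {k} (α : Monomial k) j → lookup α j ≡ 0 → suppSize (α [ j ]≔ 1) ≡ suc (suppSize α)
  suppSize-adjoin (zero  ∷ α) Fin.zero    _    = refl
  suppSize-adjoin (zero  ∷ α) (Fin.suc j) αj≡0 = suppSize-adjoin α j αj≡0
  suppSize-adjoin (suc _ ∷ α) (Fin.suc j) αj≡0 = cong suc (suppSize-adjoin α j αj≡0)

  adjoin-zero : ∀ {k} (α : Monomial k) j i → lookup (α [ j ]≔ 1) i ≡ 0 → lookup α i ≡ 0 × i ≢ j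
  adjoin-zero α j i αᵢ≡0 with i Fin.≟ j
  ... | yes refl = contradiction (trans (sym (lookup∘update j α 1)) αᵢ≡0) λ ()
  ... | no  i≢j  = trans (sym (lookup∘update′ i≢j α 1)) αᵢ≡0 , i≢j

  SquareFree-∣ₘ⇒≡ : ∀ {k} {α β : Monomial k} → SquareFree α → SquareFree β →
                    α ∣ₘ β → suppSize α ≡ suppSize β → α ≡ β
  SquareFree-∣ₘ⇒≡ sf[]     sf[]     []        _ = refl
  SquareFree-∣ₘ⇒≡ (sf0 sα) (sf0 sβ) (_ ∷ α∣β) e = cong (0 ∷_) (SquareFree-∣ₘ⇒≡ sα sβ α∣β e)
  SquareFree-∣ₘ⇒≡ (sf1 sα) (sf1 sβ) (_ ∷ α∣β) e = cong (1 ∷_) (SquareFree-∣ₘ⇒≡ sα sβ α∣β (ℕP.suc-injective e))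
  SquareFree-∣ₘ⇒≡ (sf1 sα) (sf0 sβ) (() ∷ _)  _
  SquareFree-∣ₘ⇒≡ (sf0 sα) (sf1 sβ) (_ ∷ α∣β) e =
    contradiction e (ℕP.<⇒≢ (s≤s (suppSize-mono α∣β)))

  distinguishingVar : ∀ {k} {α β : Monomial k} → SquareFree α → SquareFree β →
                      suppSize α ≤ suppSize β → β ≢ α →
                      Σ (Fin k) λ j → lookup α j ≡ 0 × lookup β j ≡ 1
  distinguishingVar sf[] sf[] _ β≢α = contradiction refl β≢α
  distinguishingVar (sf0 sα) (sf1 sβ) _ _ = Fin.zero , refl , refl
  distinguishingVar (sf0 sα) (sf0 sβ) α≤β β≢α =
    let j , αj≡0 , βj≡1 = distinguishingVar sα sβ α≤β (λ e → β≢α (cong (0 ∷_) e)) in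
    Fin.suc j , αj≡0 , βj≡1
  distinguishingVar (sf1 sα) (sf1 sβ) (s≤s α≤β) β≢α =
    let j , αj≡0 , βj≡1 = distinguishingVar sα sβ α≤β (λ e → β≢α (cong (1 ∷_) e)) in
    Fin.suc j , αj≡0 , βj≡1
  distinguishingVar {α = 1 ∷ α} {0 ∷ β} (sf1 sα) (sf0 sβ) α<β _ =
    let j , αj≡0 , βj≡1 = distinguishingVar sα sβ (ℕP.<⇒≤ α<β) (λ { refl → ℕP.<-irrefl refl α<β }) in
    Fin.suc j , αj≡0 , βj≡1

  ∈sqfree⇒SquareFree : ∀ k s {α} → α ∈ sqfree k s → SquareFree α × suppSize α ≡ s
  ∈sqfree⇒SquareFree zero    zero    (here refl) = sf[] , refl
  ∈sqfree⇒SquareFree (suc k) zero    α∈ with ∈.∈-map⁻ (0 ∷_) α∈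
  ... | _ , α′∈ , refl = let sf , deg = ∈sqfree⇒SquareFree k zero α′∈ in sf0 sf , deg
  ∈sqfree⇒SquareFree (suc k) (suc s) α∈ with ∈.∈-++⁻ (List.map (1 ∷_) (sqfree k s)) α∈
  ... | inj₁ α∈₁ with ∈.∈-map⁻ (1 ∷_) α∈₁
  ...   | _ , α′∈ , refl = let sf , deg = ∈sqfree⇒SquareFree k s α′∈ in sf1 sf , cong suc deg
  ∈sqfree⇒SquareFree (suc k) (suc s) α∈ | inj₂ α∈₀ with ∈.∈-map⁻ (0 ∷_) α∈₀
  ...   | _ , α′∈ , refl = let sf , deg = ∈sqfree⇒SquareFree k (suc s) α′∈ in sf0 sf , deg

  SquareFree⇒∈sqfree : ∀ {k} {α : Monomial k} → SquareFree α → α ∈ sqfree k (suppSize α)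
  SquareFree⇒∈sqfree sf[] = here refl
  SquareFree⇒∈sqfree {suc k} {0 ∷ α} (sf0 sf) with suppSize α | SquareFree⇒∈sqfree sf
  ... | zero  | α∈ = ∈.∈-map⁺ (0 ∷_) α∈
  ... | suc s | α∈ = ∈.∈-++⁺ʳ (List.map (1 ∷_) (sqfree k s)) (∈.∈-map⁺ (0 ∷_) α∈)
  SquareFree⇒∈sqfree (sf1 sf) = ∈.∈-++⁺ˡ (∈.∈-map⁺ (1 ∷_) (SquareFree⇒∈sqfree sf))

  sqfree-unique : ∀ k s → Unique (sqfree k s)
  sqfree-unique zero    zero    = All.[] AllPairs.∷ AllPairs.[]
  sqfree-unique zero    (suc s) = AllPairs.[]
  sqfree-unique (suc k) zero    = Unique.map⁺ ∷-injectiveʳ (sqfree-unique k zero)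
  sqfree-unique (suc k) (suc s) =
    Unique.++⁺ (Unique.map⁺ ∷-injectiveʳ (sqfree-unique k s))
               (Unique.map⁺ ∷-injectiveʳ (sqfree-unique k (suc s)))
               heads-differ
    where
    heads-differ : ∀ {α} → α ∈ List.map (1 ∷_) (sqfree k s) × α ∈ List.map (0 ∷_) (sqfree k (suc s)) → ⊥
    heads-differ (α∈₁ , α∈₀) with ∈.∈-map⁻ (1 ∷_) α∈₁ | ∈.∈-map⁻ (0 ∷_) α∈₀
    ... | _ , _ , refl | _ , _ , ()

  sqfree-divisor : ∀ {k} (α : Monomial k) s → s ≤ suppSize α → Σ (Monomial k) λ β → β ∈ sqfree k s × β ∣ₘ α
  sqfree-divisor α s s≤ = let β , sf , deg , β∣α = greedy α s s≤ in
    β , subst (λ d → β ∈ sqfree _ d) deg (SquareFree⇒∈sqfree sf) , β∣α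
    where
    greedy : ∀ {k} (α : Monomial k) s → s ≤ suppSize α →
             Σ (Monomial k) λ β → SquareFree β × suppSize β ≡ s × β ∣ₘ α
    greedy []          zero    _ = [] , sf[] , refl , []
    greedy (zero  ∷ α) s       s≤ = let β , sf , deg , β∣α = greedy α s s≤ in
      0 ∷ β , sf0 sf , deg , z≤n ∷ β∣α
    greedy (suc _ ∷ α) zero    _  = let β , sf , deg , β∣α = greedy α zero z≤n in
      0 ∷ β , sf0 sf , deg , z≤n ∷ β∣α
    greedy (suc _ ∷ α) (suc s) (s≤s s≤) = let β , sf , deg , β∣α = greedy α s s≤ in
      1 ∷ β , sf1 sf , cong suc deg , s≤s z≤n ∷ β∣α

  -- Normal form of exponents modulo the relation y^(d+2) = y: the exponent 0 is
  -- kept, a positive exponent e becomes 1 + ((e - 1) mod (d + 1)).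
  module ExponentReduction (d : ℕ) where

    reduce : ℕ → ℕ
    reduce zero    = zero
    reduce (suc e) = suc (e DivMod.% suc d)

    reduceₘ : ∀ {n} → Monomial n → Monomial n
    reduceₘ = Vec.map reduce

    reduce-small : ∀ e → e < suc (suc d) → reduce e ≡ e
    reduce-small zero    _         = refl
    reduce-small (suc e) (s≤s e<) = cong suc (DivMod.m<n⇒m%n≡m e<)

    reduceₘ-small : ∀ {n} (β : Monomial n) → (∀ j → lookup β j < suc (suc d)) → reduceₘ β ≡ β
    reduceₘ-small []      _     = refl
    reduceₘ-small (b ∷ β) small =
      cong₂ _∷_ (reduce-small b (small Fin.zero)) (reduceₘ-small β (λ j → small (Fin.suc j)))

    reduceₘ-∣ₘ : ∀ {n} (β : Monomial n) → reduceₘ β ∣ₘ β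
    reduceₘ-∣ₘ []          = []
    reduceₘ-∣ₘ (zero  ∷ β) = z≤n ∷ reduceₘ-∣ₘ β
    reduceₘ-∣ₘ (suc b ∷ β) = s≤s (DivMod.m%n≤m b (suc d)) ∷ reduceₘ-∣ₘ β

    suppSize-reduceₘ : ∀ {n} (β : Monomial n) → suppSize (reduceₘ β) ≡ suppSize β
    suppSize-reduceₘ []          = refl
    suppSize-reduceₘ (zero  ∷ β) = suppSize-reduceₘ β
    suppSize-reduceₘ (suc _ ∷ β) = cong suc (suppSize-reduceₘ β)

    reduce-period : ∀ b → reduce (b + suc (suc d)) ≡ reduce (b + 1)
    reduce-period b = begin
      reduce (b + suc (suc d))   ≡⟨ cong reduce (ℕP.+-suc b (suc d)) ⟩
      suc ((b + suc d) DivMod.% suc d) ≡⟨ cong suc (DivMod.[m+n]%n≡m%n b (suc d)) ⟩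
      suc (b DivMod.% suc d)     ≡⟨ cong reduce (ℕP.+-comm 1 b) ⟩
      reduce (b + 1)             ∎
      where open ≡-Reasoning

    reduceₘ-varPow : ∀ {n} (β : Monomial n) j →
                     reduceₘ (β ·ₘ varPow j (suc (suc d))) ≡ reduceₘ (β ·ₘ varPow j 1)
    reduceₘ-varPow β j = begin
      reduceₘ (β ·ₘ varPow j (suc (suc d)))         ≡⟨ cong reduceₘ (·ₘ-varPow β j _) ⟩
      reduceₘ (β [ j ]≔ (lookup β j + suc (suc d)))  ≡⟨ map-[]≔ reduce β j ⟩
      reduceₘ β [ j ]≔ reduce (lookup β j + suc (suc d)) ≡⟨ cong (reduceₘ β [ j ]≔_) (reduce-period (lookup β j)) ⟩
      reduceₘ β [ j ]≔ reduce (lookup β j + 1)      ≡⟨ sym (map-[]≔ reduce β j) ⟩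
      reduceₘ (β [ j ]≔ (lookup β j + 1))           ≡⟨ cong reduceₘ (sym (·ₘ-varPow β j 1)) ⟩
      reduceₘ (β ·ₘ varPow j 1)                     ∎
      where open ≡-Reasoning

    suppSize-reduceₘ-factor : ∀ {n} (β γ : Monomial n) → suppSize γ ≤ suppSize (reduceₘ (β ·ₘ γ))
    suppSize-reduceₘ-factor β γ =
      ℕP.≤-trans (suppSize-mono (factor-∣ₘ β γ)) (ℕP.≤-reflexive (sym (suppSize-reduceₘ (β ·ₘ γ))))

open Exponents

module PolynomialAlgebra {c ℓ} (F : FiniteField c ℓ) (m : ℕ) where
  open FiniteField F
  open Polynomials F m
  open import Relation.Binary.Reasoning.Setoid setoid
  open import Algebra.Properties.Ring ring using (-0#≈0#; -‿distribˡ-*; -‿+-comm)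

  Mon : Set
  Mon = Monomial m

  -- Coefficients are pairings with point
  -- masses, and the separating functional of the main argument is a pairing.
  pair : (Mon → Carrier) → Poly → Carrier
  pair w []            = 0#
  pair w ((a , β) ∷ p) = a * w β + pair w p

  pair-++ : ∀ w p r → pair w (p +P r) ≈ pair w p + pair w r
  pair-++ w []            r = sym (+-identityˡ _)
  pair-++ w ((a , β) ∷ p) r = trans (+-congˡ (pair-++ w p r)) (sym (+-assoc _ _ _))

  pair-neg : ∀ w p → pair w (-P p) ≈ - pair w p
  pair-neg w []            = sym -0#≈0#
  pair-neg w ((a , β) ∷ p) =
    trans (+-cong (sym (-‿distribˡ-* a (w β))) (pair-neg w p)) (-‿+-comm _ _)

  pair-congʷ : ∀ {w w′} → (∀ β → w β ≈ w′ β) → ∀ p → pair w p ≈ pair w′ p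
  pair-congʷ w≈w′ []            = refl
  pair-congʷ w≈w′ ((a , β) ∷ p) = +-cong (*-congˡ (w≈w′ β)) (pair-congʷ w≈w′ p)

  pair-zeroʷ : ∀ {w} → (∀ β → w β ≈ 0#) → ∀ p → pair w p ≈ 0#
  pair-zeroʷ w≈0 []            = refl
  pair-zeroʷ w≈0 ((a , β) ∷ p) =
    trans (+-cong (trans (*-congˡ (w≈0 β)) (zeroʳ a)) (pair-zeroʷ w≈0 p)) (+-identityˡ 0#)

  pair-+ʷ : ∀ w w′ p → pair (λ β → w β + w′ β) p ≈ pair w p + pair w′ p
  pair-+ʷ w w′ []            = sym (+-identityˡ 0#)
  pair-+ʷ w w′ ((a , β) ∷ p) = begin
    a * (w β + w′ β) + pair (λ β → w β + w′ β) p   ≈⟨ +-cong (distribˡ a _ _) (pair-+ʷ w w′ p) ⟩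
    (a * w β + a * w′ β) + (pair w p + pair w′ p)   ≈⟨ +-assoc _ _ _ ⟩
    a * w β + (a * w′ β + (pair w p + pair w′ p))   ≈⟨ +-congˡ (trans (sym (+-assoc _ _ _))
                                                         (trans (+-congʳ (+-comm _ _)) (+-assoc _ _ _))) ⟩
    a * w β + (pair w p + (a * w′ β + pair w′ p))   ≈⟨ sym (+-assoc _ _ _) ⟩
    (a * w β + pair w p) + (a * w′ β + pair w′ p)   ∎

  pair-*ʷ : ∀ b w p → pair (λ β → b * w β) p ≈ b * pair w p
  pair-*ʷ b w []            = sym (zeroʳ b)
  pair-*ʷ b w ((a , β) ∷ p) = trans
    (+-cong (trans (sym (*-assoc _ _ _)) (trans (*-congʳ (*-comm a b)) (*-assoc _ _ _))) (pair-*ʷ b w p))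
    (sym (distribˡ b _ _))

  pair-swap : ∀ (K : Mon → Mon → Carrier) p r →
              pair (λ β → pair (K β) r) p ≈ pair (λ γ → pair (λ β → K β γ) p) r
  pair-swap K []            r = sym (pair-zeroʷ (λ _ → refl) r)
  pair-swap K ((a , β) ∷ p) r = begin
    a * pair (K β) r + pair (λ β → pair (K β) r) p
      ≈⟨ +-cong (sym (pair-*ʷ a (K β) r)) (pair-swap K p r) ⟩
    pair (λ γ → a * K β γ) r + pair (λ γ → pair (λ β → K β γ) p) r
      ≈⟨ sym (pair-+ʷ _ _ r) ⟩
    pair (λ γ → a * K β γ + pair (λ β → K β γ) p) r ∎

  pair-* : ∀ w p r → pair w (p *P r) ≈ pair (λ β → pair (λ γ → w (β ·ₘ γ)) r) p
  pair-* w []            r = refl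
  pair-* w ((a , β) ∷ p) r =
    -- the product unfolds to  (a y^β · r) ++ (p *P r), and  a y^β · r  is
    -- ((a , β) ∷ []) *P r  up to a trailing []
    trans (pair-++ w (List.map _ r) (p *P r))
          (+-cong (trans (reflexive (≡.cong (pair w) (≡.sym (ListP.++-identityʳ (List.map _ r))))) (pair-monomial r))
                  (pair-* w p r))
    where
    pair-monomial : ∀ r → pair w (((a , β) ∷ []) *P r) ≈ a * pair (λ γ → w (β ·ₘ γ)) r
    pair-monomial []            = sym (zeroʳ a)
    pair-monomial ((b , γ) ∷ r) = begin
      a * b * w (β ·ₘ γ) + pair w (((a , β) ∷ []) *P r)
        ≈⟨ +-cong (*-assoc a b _) (pair-monomial r) ⟩
      a * (b * w (β ·ₘ γ)) + a * pair (λ γ → w (β ·ₘ γ)) r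
        ≈⟨ sym (distribˡ a _ _) ⟩
      a * (b * w (β ·ₘ γ) + pair (λ γ → w (β ·ₘ γ)) r) ∎

  δ : Mon → Mon → Carrier
  δ α β with ≡-dec ℕP._≟_ β α
  ... | yes _ = 1#
  ... | no  _ = 0#

  δ-≡ : ∀ {α β} → β ≡ α → δ α β ≈ 1#
  δ-≡ {α} {β} β≡α with ≡-dec ℕP._≟_ β α
  ... | yes _   = refl
  ... | no  β≢α = ⊥-elim (β≢α β≡α)

  δ-≢ : ∀ {α β} → β ≢ α → δ α β ≈ 0#
  δ-≢ {α} {β} β≢α with ≡-dec ℕP._≟_ β α
  ... | yes β≡α = ⊥-elim (β≢α β≡α)
  ... | no  _   = refl

  coeff≈pair-δ : ∀ p α → coeff p α ≈ pair (δ α) p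
  coeff≈pair-δ []            α = refl
  coeff≈pair-δ ((a , β) ∷ p) α with ≡-dec ℕP._≟_ β α
  ... | yes _ = +-cong (sym (*-identityʳ a)) (coeff≈pair-δ p α)
  ... | no  _ = trans (coeff≈pair-δ p α) (sym (trans (+-congʳ (zeroʳ a)) (+-identityˡ _)))

  coeff-∷-≡ : ∀ a β p → coeff ((a , β) ∷ p) β ≈ a + coeff p β
  coeff-∷-≡ a β p with ≡-dec ℕP._≟_ β β
  ... | yes _   = refl
  ... | no  β≢β = ⊥-elim (β≢β ≡.refl)

  coeff-∷-≢ : ∀ a β p γ → β ≢ γ → coeff ((a , β) ∷ p) γ ≈ coeff p γ
  coeff-∷-≢ a β p γ β≢γ with ≡-dec ℕP._≟_ β γ
  ... | yes β≡γ = ⊥-elim (β≢γ β≡γ)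
  ... | no  _   = refl

  -- A pairing only depends on the coefficients.  Proof: collect all terms
  -- with the monomial β of the head term (removeTerms β) and recurse on the
  -- strictly shorter rest.

  removeTerms : Mon → Poly → Poly
  removeTerms β []            = []
  removeTerms β ((a , γ) ∷ p) with ≡-dec ℕP._≟_ γ β
  ... | yes _ = removeTerms β p
  ... | no  _ = (a , γ) ∷ removeTerms β p

  removeTerms-length : ∀ β p → length (removeTerms β p) ≤ length p
  removeTerms-length β []            = z≤n
  removeTerms-length β ((a , γ) ∷ p) with ≡-dec ℕP._≟_ γ β
  ... | yes _ = ℕP.m≤n⇒m≤1+n (removeTerms-length β p)
  ... | no  _ = s≤s (removeTerms-length β p)

  pair-removeTerms : ∀ w β p → pair w p ≈ coeff p β * w β + pair w (removeTerms β p)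
  pair-removeTerms w β []            = sym (trans (+-identityʳ _) (zeroˡ (w β)))
  pair-removeTerms w β ((a , γ) ∷ p) with ≡-dec ℕP._≟_ γ β
  ... | yes ≡.refl = trans (+-congˡ (pair-removeTerms w γ p))
                     (trans (sym (+-assoc _ _ _)) (+-congʳ (sym (distribʳ (w γ) a _))))
  ... | no  _      = trans (+-congˡ (pair-removeTerms w β p))
                     (trans (sym (+-assoc _ _ _)) (trans (+-congʳ (+-comm _ _)) (+-assoc _ _ _)))

  coeff-removeTerms-≡ : ∀ β p → coeff (removeTerms β p) β ≈ 0#
  coeff-removeTerms-≡ β []            = refl
  coeff-removeTerms-≡ β ((a , γ) ∷ p) with ≡-dec ℕP._≟_ γ β
  ... | yes _   = coeff-removeTerms-≡ β p
  ... | no  γ≢β = trans (coeff-∷-≢ a γ (removeTerms β p) β γ≢β) (coeff-removeTerms-≡ β p)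

  coeff-removeTerms-≢ : ∀ β γ → γ ≢ β → ∀ p → coeff (removeTerms β p) γ ≈ coeff p γ
  coeff-removeTerms-≢ β γ γ≢β []             = refl
  coeff-removeTerms-≢ β γ γ≢β ((a , γ′) ∷ p) with ≡-dec ℕP._≟_ γ′ β | ≡-dec ℕP._≟_ γ′ γ
  ... | yes ≡.refl | yes ≡.refl = ⊥-elim (γ≢β ≡.refl)
  ... | yes _      | no  _      = coeff-removeTerms-≢ β γ γ≢β p
  ... | no  _      | yes ≡.refl = trans (coeff-∷-≡ a γ′ (removeTerms β p)) (+-congˡ (coeff-removeTerms-≢ β γ γ≢β p))
  ... | no  _      | no  γ′≢γ   = trans (coeff-∷-≢ a γ′ (removeTerms β p) γ γ′≢γ) (coeff-removeTerms-≢ β γ γ≢β p)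

  pair-vanishes : ∀ w p → (∀ α → coeff p α ≈ 0# ⊎ w α ≈ 0#) → pair w p ≈ 0#
  pair-vanishes w p = go (length p) p ℕP.≤-refl
    where
    go : ∀ n p → length p ≤ n → (∀ α → coeff p α ≈ 0# ⊎ w α ≈ 0#) → pair w p ≈ 0#
    go n       []            _         _    = refl
    go (suc n) ((a , β) ∷ p) (s≤s len) null = begin
      a * w β + pair w p                                   ≈⟨ +-congˡ (pair-removeTerms w β p) ⟩
      a * w β + (coeff p β * w β + pair w (removeTerms β p)) ≈⟨ sym (+-assoc _ _ _) ⟩
      (a * w β + coeff p β * w β) + pair w (removeTerms β p) ≈⟨ +-congʳ (sym (distribʳ (w β) a _)) ⟩
      (a + coeff p β) * w β + pair w (removeTerms β p)       ≈⟨ +-cong head-term rest ⟩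
      0# + 0#                                              ≈⟨ +-identityˡ 0# ⟩
      0#                                                   ∎
      where
      head-term : (a + coeff p β) * w β ≈ 0#
      head-term with null β
      ... | inj₁ c≈0 = trans (*-congʳ (trans (sym (coeff-∷-≡ a β p)) c≈0)) (zeroˡ _)
      ... | inj₂ w≈0 = trans (*-congˡ w≈0) (zeroʳ _)
      null-rest : ∀ γ → coeff (removeTerms β p) γ ≈ 0# ⊎ w γ ≈ 0#
      null-rest γ with ≡-dec ℕP._≟_ γ β
      ... | yes ≡.refl = inj₁ (coeff-removeTerms-≡ β p)
      ... | no  γ≢β with null γ
      ...   | inj₁ c≈0 = inj₁ (trans (coeff-removeTerms-≢ β γ γ≢β p)
                                 (trans (sym (coeff-∷-≢ a β p γ (λ e → γ≢β (≡.sym e)))) c≈0))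
      ...   | inj₂ w≈0 = inj₂ w≈0
      rest : pair w (removeTerms β p) ≈ 0#
      rest = go n (removeTerms β p) (ℕP.≤-trans (removeTerms-length β p) len) null-rest

  coeff-++ : ∀ p r α → coeff (p +P r) α ≈ coeff p α + coeff r α
  coeff-++ p r α = trans (coeff≈pair-δ (p ++ r) α)
    (trans (pair-++ (δ α) p r) (sym (+-cong (coeff≈pair-δ p α) (coeff≈pair-δ r α))))

  coeff-neg : ∀ p α → coeff (-P p) α ≈ - coeff p α
  coeff-neg p α = trans (coeff≈pair-δ (-P p) α) (trans (pair-neg (δ α) p) (-‿cong (sym (coeff≈pair-δ p α))))

  coeff-* : ∀ p r α → coeff (p *P r) α ≈ pair (λ β → pair (λ γ → δ α (β ·ₘ γ)) r) p
  coeff-* p r α = trans (coeff≈pair-δ (p *P r) α) (pair-* (δ α) p r)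

  pair-cong : ∀ w p r → p ≈P r → pair w p ≈ pair w r
  pair-cong w p r p≈r = begin
    pair w p                           ≈⟨ sym (+-identityʳ _) ⟩
    pair w p + 0#                      ≈⟨ +-congˡ (sym (-‿inverseˡ _)) ⟩
    pair w p + (- pair w r + pair w r) ≈⟨ sym (+-assoc _ _ _) ⟩
    (pair w p + - pair w r) + pair w r ≈⟨ +-congʳ (sym (trans (pair-++ w p (-P r)) (+-congˡ (pair-neg w r)))) ⟩
    pair w (p +P (-P r)) + pair w r    ≈⟨ +-congʳ (pair-vanishes w (p +P (-P r)) (λ α → inj₁ (difference≈0 α))) ⟩
    0# + pair w r                      ≈⟨ +-identityˡ _ ⟩
    pair w r                           ∎
    where
    difference≈0 : ∀ α → coeff (p +P (-P r)) α ≈ 0#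
    difference≈0 α = trans (coeff-++ p (-P r) α)
      (trans (+-cong (p≈r α) (coeff-neg r α)) (-‿inverseʳ _))

  -- Polynomials form a commutative ring up to equality of coefficients.

  -- Equality of coefficients, wrapped in a record so that the two compared
  -- polynomials can be inferred from a proof.
  record _≋_ (p r : Poly) : Set ℓ where
    constructor mk≋
    field get : p ≈P r
  open _≋_ public

  1P : Poly
  1P = mono oneₘ

  private
    +P-cong : ∀ {p p′ r r′} → p ≋ p′ → r ≋ r′ → (p +P r) ≈P (p′ +P r′)
    +P-cong {p} {p′} {r} {r′} p≋ r≋ α =
      trans (coeff-++ p r α) (trans (+-cong (get p≋ α) (get r≋ α)) (sym (coeff-++ p′ r′ α)))

    -P-cong : ∀ {p p′} → p ≋ p′ → (-P p) ≈P (-P p′)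
    -P-cong {p} {p′} p≋ α = trans (coeff-neg p α) (trans (-‿cong (get p≋ α)) (sym (coeff-neg p′ α)))

    *P-cong : ∀ {p p′ r r′} → p ≋ p′ → r ≋ r′ → (p *P r) ≈P (p′ *P r′)
    *P-cong {p} {p′} {r} {r′} p≋ r≋ α = begin
      coeff (p *P r) α                                  ≈⟨ coeff-* p r α ⟩
      pair (λ β → pair (λ γ → δ α (β ·ₘ γ)) r) p        ≈⟨ pair-cong _ p p′ (get p≋) ⟩
      pair (λ β → pair (λ γ → δ α (β ·ₘ γ)) r) p′       ≈⟨ pair-congʷ (λ β → pair-cong _ r r′ (get r≋)) p′ ⟩
      pair (λ β → pair (λ γ → δ α (β ·ₘ γ)) r′) p′      ≈⟨ sym (coeff-* p′ r′ α) ⟩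
      coeff (p′ *P r′) α                                ∎

    *P-comm : ∀ p r → (p *P r) ≈P (r *P p)
    *P-comm p r α = begin
      coeff (p *P r) α                                  ≈⟨ coeff-* p r α ⟩
      pair (λ β → pair (λ γ → δ α (β ·ₘ γ)) r) p        ≈⟨ pair-swap (λ β γ → δ α (β ·ₘ γ)) p r ⟩
      pair (λ γ → pair (λ β → δ α (β ·ₘ γ)) p) r        ≈⟨ pair-congʷ (λ γ → pair-congʷ
                                                             (λ β → reflexive (≡.cong (δ α) (·ₘ-comm β γ))) p) r ⟩
      pair (λ γ → pair (λ β → δ α (γ ·ₘ β)) p) r        ≈⟨ sym (coeff-* r p α) ⟩
      coeff (r *P p) α                                  ∎

    *P-assoc : ∀ p r s → ((p *P r) *P s) ≈P (p *P (r *P s))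
    *P-assoc p r s α = begin
      coeff ((p *P r) *P s) α                           ≈⟨ coeff-* (p *P r) s α ⟩
      pair (λ β → pair (λ γ → δ α (β ·ₘ γ)) s) (p *P r) ≈⟨ pair-* _ p r ⟩
      pair (λ β → pair (λ γ → pair (λ ε → δ α ((β ·ₘ γ) ·ₘ ε)) s) r) p
        ≈⟨ pair-congʷ (λ β → pair-congʷ (λ γ → pair-congʷ
             (λ ε → reflexive (≡.cong (δ α) (·ₘ-assoc β γ ε))) s) r) p ⟩
      pair (λ β → pair (λ γ → pair (λ ε → δ α (β ·ₘ (γ ·ₘ ε))) s) r) p
        ≈⟨ sym (pair-congʷ (λ β → pair-* (λ γ → δ α (β ·ₘ γ)) r s) p) ⟩
      pair (λ β → pair (λ γ → δ α (β ·ₘ γ)) (r *P s)) p ≈⟨ sym (coeff-* p (r *P s) α) ⟩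
      coeff (p *P (r *P s)) α                           ∎

    *P-identityˡ : ∀ p → (1P *P p) ≈P p
    *P-identityˡ p α = begin
      coeff (1P *P p) α                              ≈⟨ coeff-* 1P p α ⟩
      1# * pair (λ γ → δ α (oneₘ ·ₘ γ)) p + 0#       ≈⟨ trans (+-identityʳ _) (*-identityˡ _) ⟩
      pair (λ γ → δ α (oneₘ ·ₘ γ)) p                 ≈⟨ pair-congʷ (λ γ → reflexive (≡.cong (δ α) (·ₘ-identityˡ γ))) p ⟩
      pair (δ α) p                                   ≈⟨ sym (coeff≈pair-δ p α) ⟩
      coeff p α                                      ∎

    *P-distribˡ : ∀ p r s → (p *P (r +P s)) ≈P ((p *P r) +P (p *P s))
    *P-distribˡ p r s α = begin
      coeff (p *P (r +P s)) α                         ≈⟨ coeff-* p (r ++ s) α ⟩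
      pair (λ β → pair (λ γ → δ α (β ·ₘ γ)) (r ++ s)) p ≈⟨ pair-congʷ (λ β → pair-++ _ r s) p ⟩
      pair (λ β → pair (λ γ → δ α (β ·ₘ γ)) r + pair (λ γ → δ α (β ·ₘ γ)) s) p ≈⟨ pair-+ʷ _ _ p ⟩
      _ + _                                           ≈⟨ sym (+-cong (coeff-* p r α) (coeff-* p s α)) ⟩
      coeff (p *P r) α + coeff (p *P s) α             ≈⟨ sym (coeff-++ (p *P r) (p *P s) α) ⟩
      coeff ((p *P r) +P (p *P s)) α                  ∎

    ≡⇒≈P : ∀ {p r} → p ≡ r → p ≈P r
    ≡⇒≈P ≡.refl α = refl

    -P-inverseʳ : ∀ p → (p +P (-P p)) ≈P 0P
    -P-inverseʳ p α = trans (coeff-++ p (-P p) α) (trans (+-congˡ (coeff-neg p α)) (-‿inverseʳ _))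

    -P-inverseˡ : ∀ p → ((-P p) +P p) ≈P 0P
    -P-inverseˡ p α = trans (coeff-++ (-P p) p α) (trans (+-congʳ (coeff-neg p α)) (-‿inverseˡ _))

    +P-comm : ∀ p r → (p +P r) ≈P (r +P p)
    +P-comm p r α = trans (coeff-++ p r α) (trans (+-comm _ _) (sym (coeff-++ r p α)))

  polyIsCommutativeRing : IsCommutativeRing _≋_ _+P_ _*P_ -P_ 0P 1P
  polyIsCommutativeRing = record
    { isRing = record
      { +-isAbelianGroup = record
        { isGroup = record
          { isMonoid = record
            { isSemigroup = record
              { isMagma = record
                { isEquivalence = record
                  { refl  = mk≋ (λ α → refl)
                  ; sym   = λ p≋r → mk≋ (λ α → sym (get p≋r α))
                  ; trans = λ p≋r r≋s → mk≋ (λ α → trans (get p≋r α) (get r≋s α)) }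
                ; ∙-cong = λ p≋ r≋ → mk≋ (+P-cong p≋ r≋) }
              ; assoc = λ p r s → mk≋ (≡⇒≈P (ListP.++-assoc p r s)) }
            ; identity = (λ p → mk≋ (λ α → refl)) , (λ p → mk≋ (≡⇒≈P (ListP.++-identityʳ p))) }
          ; inverse = (λ p → mk≋ (-P-inverseˡ p)) , (λ p → mk≋ (-P-inverseʳ p))
          ; ⁻¹-cong = λ p≋ → mk≋ (-P-cong p≋) }
        ; comm = λ p r → mk≋ (+P-comm p r) }
      ; *-cong = λ p≋ r≋ → mk≋ (*P-cong p≋ r≋)
      ; *-assoc = λ p r s → mk≋ (*P-assoc p r s)
      ; *-identity = (λ p → mk≋ (*P-identityˡ p))
                   , (λ p → mk≋ (λ α → trans (*P-comm p 1P α) (*P-identityˡ p α)))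
      ; distrib = (λ p r s → mk≋ (*P-distribˡ p r s))
                , (λ p r s → mk≋ (≡⇒≈P (ListP.concatMap-++ _ r s))) }
    ; *-comm = λ p r → mk≋ (*P-comm p r) }

  polyRing : CommutativeRing c ℓ
  polyRing = record { isCommutativeRing = polyIsCommutativeRing }

  module R = CommutativeRing polyRing
  open import Algebra.Properties.Ring R.ring public
    using () renaming (-‿distribˡ-* to -P‿distribˡ-*; -‿distribʳ-* to -P‿distribʳ-*;
                       -‿+-comm to -P‿+-comm; -‿involutive to -P‿involutive)

  sumFin-suc : ∀ {n} (f : Fin (suc n) → Poly) → sumFin f ≡ (f Fin.zero +P sumFin (λ i → f (Fin.suc i)))
  sumFin-suc f = ≡.cong (λ fs → f Fin.zero ++ List.foldr _++_ [] fs)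
    (≡.trans (ListP.map-tabulate Fin.suc f) (≡.sym (ListP.map-tabulate (λ i → i) (λ i → f (Fin.suc i)))))

  sumFin-cong : ∀ {n} {f g : Fin n → Poly} → (∀ i → f i ≋ g i) → sumFin f ≋ sumFin g
  sumFin-cong {zero}          f≋g = R.refl
  sumFin-cong {suc n} {f} {g} f≋g rewrite sumFin-suc f | sumFin-suc g =
    R.+-cong (f≋g Fin.zero) (sumFin-cong (λ i → f≋g (Fin.suc i)))

  sumFin-+ : ∀ {n} (f g : Fin n → Poly) → sumFin (λ i → f i +P g i) ≋ (sumFin f +P sumFin g)
  sumFin-+ {zero}  f g = R.refl
  sumFin-+ {suc n} f g rewrite sumFin-suc (λ i → f i +P g i) | sumFin-suc f | sumFin-suc g =
    R.trans (R.+-congˡ (sumFin-+ (λ i → f (Fin.suc i)) (λ i → g (Fin.suc i))))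
            (interchange (f Fin.zero) (g Fin.zero) _ _)
    where open import Algebra.Properties.CommutativeSemigroup R.+-commutativeSemigroup using (interchange)

  sumFin-*ˡ : ∀ {n} r (f : Fin n → Poly) → (r *P sumFin f) ≋ sumFin (λ i → r *P f i)
  sumFin-*ˡ {zero}  r f = R.zeroʳ r
  sumFin-*ˡ {suc n} r f rewrite sumFin-suc f | sumFin-suc (λ i → r *P f i) =
    R.trans (R.distribˡ r _ _) (R.+-congˡ (sumFin-*ˡ r (λ i → f (Fin.suc i))))

  sumFin-zero : ∀ n → sumFin {n} (λ _ → 0P) ≋ 0P
  sumFin-zero zero    = R.refl
  sumFin-zero (suc n) rewrite sumFin-suc {n} (λ _ → 0P) = sumFin-zero n

  sumFin-single : ∀ {n} (k : Fin n) (f : Fin n → Poly) → (∀ i → i ≢ k → f i ≋ 0P) → sumFin f ≋ f k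
  sumFin-single {suc n} Fin.zero    f f≋0 rewrite sumFin-suc f =
    R.trans (R.+-congˡ (R.trans (sumFin-cong (λ i → f≋0 (Fin.suc i) (λ ()))) (sumFin-zero n))) (R.+-identityʳ _)
  sumFin-single {suc n} (Fin.suc k) f f≋0 rewrite sumFin-suc f =
    R.trans (R.+-congʳ (f≋0 Fin.zero (λ ())))
      (R.trans (R.+-identityˡ _)
        (sumFin-single k (λ i → f (Fin.suc i)) (λ i i≢k → f≋0 (Fin.suc i) (λ e → i≢k (suc-injective e)))))

  pair-sumFin-zero : ∀ w {n} (f : Fin n → Poly) → (∀ i → pair w (f i) ≈ 0#) → pair w (sumFin f) ≈ 0#
  pair-sumFin-zero w {zero}  f f≈0 = refl
  pair-sumFin-zero w {suc n} f f≈0 rewrite sumFin-suc f =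
    trans (pair-++ w (f Fin.zero) _)
      (trans (+-cong (f≈0 Fin.zero) (pair-sumFin-zero w (λ i → f (Fin.suc i)) (λ i → f≈0 (Fin.suc i))))
             (+-identityˡ 0#))

  module Ideal (gens : List Poly) where
    gen : Fin (length gens) → Poly
    gen = List.lookup gens

    -- InIdeal gens, with ≋ in place of ≈P so that the member can be inferred
    _∈I : Poly → Set (c ⊔ ℓ)
    f ∈I = Σ (Fin (length gens) → Poly) λ h → f ≋ sumFin (λ i → h i *P gen i)

    ∈I⇒InIdeal : ∀ {f} → f ∈I → InIdeal gens f
    ∈I⇒InIdeal (h , f≋) = h , get f≋

    ∈I-resp : ∀ {f g} → f ≋ g → f ∈I → g ∈I
    ∈I-resp f≋g (h , f≋) = h , R.trans (R.sym f≋g) f≋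

    ∈I-zero : 0P ∈I
    ∈I-zero = (λ _ → 0P) , R.sym (R.trans (sumFin-cong (λ i → R.zeroˡ (gen i))) (sumFin-zero (length gens)))

    ∈I-+ : ∀ {f g} → f ∈I → g ∈I → (f +P g) ∈I
    ∈I-+ (h , f≋) (h′ , g≋) = (λ i → h i +P h′ i) , R.trans (R.+-cong f≋ g≋)
      (R.trans (R.sym (sumFin-+ (λ i → h i *P gen i) (λ i → h′ i *P gen i)))
               (sumFin-cong (λ i → R.sym (R.distribʳ (gen i) (h i) (h′ i)))))

    ∈I-* : ∀ r {f} → f ∈I → (r *P f) ∈I
    ∈I-* r (h , f≋) = (λ i → r *P h i) , R.trans (R.*-congˡ {r} f≋)
      (R.trans (sumFin-*ˡ r (λ i → h i *P gen i)) (sumFin-cong (λ i → R.sym (R.*-assoc r (h i) (gen i)))))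

    ∈I-neg : ∀ {f} → f ∈I → (-P f) ∈I
    ∈I-neg {f} f∈ = ∈I-resp (R.trans (R.sym (-P‿distribˡ-* 1P f)) (R.-‿cong (R.*-identityˡ f))) (∈I-* (-P 1P) f∈)

    ∈I-cancel : ∀ {f g} → (f +P g) ∈I → g ∈I → f ∈I
    ∈I-cancel {f} {g} f+g∈ g∈ = ∈I-resp cancel (∈I-+ f+g∈ (∈I-neg g∈))
      where
      cancel : ((f +P g) +P (-P g)) ≋ f
      cancel = R.trans (R.+-assoc f g (-P g)) (R.trans (R.+-congˡ (R.-‿inverseʳ g)) (R.+-identityʳ f))

    ∈I-gen : ∀ {g} → g ∈ gens → g ∈I
    ∈I-gen g∈ = ∈I-resp (R.reflexive (≡.sym (AnyP.lookup-index g∈))) (lookup∈I (Any.index g∈))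
      where
      lookup∈I : ∀ k → gen k ∈I
      lookup∈I k = indicator , R.sym (R.trans (sumFin-single k _ others) at-k)
        where
        indicator : Fin (length gens) → Poly
        indicator i with i Fin.≟ k
        ... | yes _ = 1P
        ... | no  _ = 0P
        others : ∀ i → i ≢ k → (indicator i *P gen i) ≋ 0P
        others i i≢k with i Fin.≟ k
        ... | yes i≡k = ⊥-elim (i≢k i≡k)
        ... | no  _   = R.zeroˡ (gen i)
        at-k : (indicator k *P gen k) ≋ gen k
        at-k with k Fin.≟ k
        ... | yes _   = R.*-identityˡ (gen k)
        ... | no  k≢k = ⊥-elim (k≢k ≡.refl)

  mono-* : ∀ α β → (mono α *P mono β) ≋ mono (α ·ₘ β)
  mono-* α β = mk≋ coeff≈
    where
    coeff≈ : ∀ γ → coeff (mono α *P mono β) γ ≈ coeff (mono (α ·ₘ β)) γ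
    coeff≈ γ with ≡-dec ℕP._≟_ (α ·ₘ β) γ
    ... | yes _ = +-congʳ (*-identityˡ 1#)
    ... | no  _ = refl

  -- Σ_{U ∈ Us} y^U;  the elementary symmetric polynomial σ_s is  monoSum (sqfree m s).
  monoSum : List Mon → Poly
  monoSum = List.map (λ α → (1# , α))

  pair-monoSum-zero : ∀ w Us → (∀ {U} → U ∈ Us → w U ≈ 0#) → pair w (monoSum Us) ≈ 0#
  pair-monoSum-zero w []       _     = refl
  pair-monoSum-zero w (U ∷ Us) w≈0 =
    trans (+-cong (trans (*-congˡ (w≈0 (Any.here ≡.refl))) (zeroʳ 1#))
                  (pair-monoSum-zero w Us (λ U∈ → w≈0 (Any.there U∈))))
          (+-identityˡ 0#)

module TermOrderFacts {m} (ord : TermOrder m) where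
  open TermOrder ord
  open IsStrictTotalOrder isStrictTotalOrder using (asym) public

  ∣ₘ⇒< : ∀ {β α} → β ∣ₘ α → β ≢ α → β < α
  ∣ₘ⇒< {β} d β≢α with ∣ₘ⇒factor d
  ... | γ , ≡.refl with ≡-dec ℕP._≟_ γ oneₘ
  ...   | yes ≡.refl = ⊥-elim (β≢α (≡.sym (·ₘ-identityʳ β)))
  ...   | no  γ≢1    = ≡.subst₂ _<_ (·ₘ-identityˡ β) (·ₘ-comm γ β) (mult-compatible oneₘ γ β (one-least γ γ≢1))

module FieldFacts {c ℓ} (F : FiniteField c ℓ) where
  open FiniteField F

  private
    index : Carrier → Fin size
    index = Inverse.to enumerate

    index-injective : ∀ {x y} → index x ≡ index y → x ≈ y
    index-injective = Injection.injective (Inverse⇒Injection enumerate)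

  _≟F_ : ∀ x y → Dec (x ≈ y)
  x ≟F y with index x Fin.≟ index y
  ... | yes e = yes (index-injective e)
  ... | no  n = no (λ x≈y → n (Inverse.to-cong enumerate x≈y))

  2≤size : 2 ≤ size
  2≤size = distinct⇒2≤ (index 0#) (index 1#) (λ e → 0≉1 (index-injective e))
    where
    distinct⇒2≤ : ∀ {n} (a b : Fin n) → a ≢ b → 2 ≤ n
    distinct⇒2≤ {suc zero}    Fin.zero Fin.zero a≢b = ⊥-elim (a≢b ≡.refl)
    distinct⇒2≤ {suc (suc n)} _        _        _   = s≤s (s≤s z≤n)

  q∸2 : ℕ
  q∸2 = size ℕ.∸ 2

  size≡2+q∸2 : size ≡ 2 ℕ.+ q∸2
  size≡2+q∸2 = ≡.sym (ℕP.m+[n∸m]≡n 2≤size)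

module LeadingMonomials {c ℓ} (F : FiniteField c ℓ) (m : ℕ) (ord : TermOrder m) where
  open FiniteField F
  open Polynomials F m
  open PolynomialAlgebra F m using (Mon; coeff-∷-≡; coeff-∷-≢)
  open TermOrder ord
  open TermOrderFacts ord

  LM-unique : ∀ {p α β} → IsLM ord p α → IsLM ord p β → α ≡ β
  LM-unique (α∈ , below-α) (β∈ , below-β) with below-α _ β∈ | below-β _ α∈
  ... | inj₁ β≡α | _         = ≡.sym β≡α
  ... | inj₂ _   | inj₁ α≡β  = α≡β
  ... | inj₂ β<α | inj₂ α<β  = ⊥-elim (asym β<α α<β)

  coeff-mono : ∀ α → coeff (mono α) α ≈ 1#
  coeff-mono α = trans (coeff-∷-≡ 1# α []) (+-identityʳ 1#)

  support-mono : ∀ α β → InSupport (mono α) β → β ≡ α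
  support-mono α β β∈ with ≡-dec ℕP._≟_ α β
  ... | yes α≡β = ≡.sym α≡β
  ... | no  _   = ⊥-elim (β∈ refl)

  LM-mono : ∀ α → IsLM ord (mono α) α
  LM-mono α = (λ c≈0 → 0≉1 (trans (sym c≈0) (coeff-mono α))) , λ β β∈ → inj₁ (support-mono α β β∈)

  record ReducedGBCriteria (gens G : List Poly) : Set (c ⊔ ℓ) where
    field
      distinct     : Unique G
      inIdeal      : ∀ {g} → g ∈ G → InIdeal gens g
      monicLM      : ∀ {g} → g ∈ G → Σ Mon λ β → IsLM ord g β × coeff g β ≈ 1#
      leading      : ∀ f → InIdeal gens f → ∀ α → IsLM ord f α →
                     Σ Poly λ g → g ∈ G × Σ Mon λ β → IsLM ord g β × β ∣ₘ α
      interreduced : ∀ {g g′ α β} → g ∈ G → g′ ∈ G → InSupport g α → IsLM ord g′ β → β ∣ₘ α → g ≡ g′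

  Unique⇒lookup-injective : ∀ {a} {A : Set a} {xs : List A} → Unique xs →
                            ∀ i j → i ≢ j → List.lookup xs i ≢ List.lookup xs j
  Unique⇒lookup-injective (x∉ ∷ _)  Fin.zero    Fin.zero    0≢0 _ = 0≢0 ≡.refl
  Unique⇒lookup-injective (x∉ ∷ _)  Fin.zero    (Fin.suc j) _   e = All.lookup x∉ (∈.∈-lookup j) e
  Unique⇒lookup-injective (x∉ ∷ _)  (Fin.suc i) Fin.zero    _   e = All.lookup x∉ (∈.∈-lookup i) (≡.sym e)
  Unique⇒lookup-injective (_ ∷ uniq) (Fin.suc i) (Fin.suc j) i≢j e =
    Unique⇒lookup-injective uniq i j (λ i≡j → i≢j (≡.cong Fin.suc i≡j)) e

  criteria⇒IsReducedGB : ∀ {gens G} → ReducedGBCriteria gens G → IsReducedGB ord gens G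
  criteria⇒IsReducedGB {gens} {G} crit = record
    { inIdeal = λ i → inIdeal (∈.∈-lookup i)
    ; nonzero = λ i → let β , lm , _ = monicLM (∈.∈-lookup i) in β , lm
    ; monic   = λ i α lm → let β , lmβ , monic = monicLM (∈.∈-lookup i) in
                           trans (reflexive (≡.cong (coeff (List.lookup G i)) (LM-unique {List.lookup G i} lm lmβ))) monic
    ; leading = λ f f∈ α lm → let g , g∈ , β , lmβ , β∣α = leading f f∈ α lm in
                              Any.index g∈ , β , ≡.subst (λ h → IsLM ord h β) (AnyP.lookup-index g∈) lmβ , β∣α
    ; reduced = λ i j i≢j α β α∈ lmβ β∣α →
                  Unique⇒lookup-injective distinct i j i≢j
                    (interreduced (∈.∈-lookup i) (∈.∈-lookup j) α∈ lmβ β∣α)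
    }
    where open ReducedGBCriteria crit

module Generators {c ℓ} (F : FiniteField c ℓ) (m t : ℕ) where
  open Polynomials F m
  open Specific F m
  open PolynomialAlgebra F m
  open Ideal (Igens t)
  open FieldFacts F using (q∸2; size≡2+q∸2)
  open import Relation.Binary.Reasoning.Setoid R.setoid
  open import Algebra.Properties.CommutativeSemigroup R.*-commutativeSemigroup
    using (interchange; xy∙z≈xz∙y; xy∙z≈x∙zy; xy∙z≈y∙xz; x∙yz≈y∙xz)

  y : Fin m → ℕ → Poly
  y j a = mono (varPow j a)

  fieldEq : Fin m → Poly
  fieldEq j = y j q +P (-P var j)

  fieldEq∈Igens : ∀ j → fieldEq j ∈ Igens t
  fieldEq∈Igens j = ∈.∈-++⁺ʳ (List.map (λ i → σ (t ℕ.+ i)) (upTo (suc m ℕ.∸ t)))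
                              (∈.∈-map⁺ fieldEq (∈.∈-allFin j))

  σ∈Igens : ∀ s → t ≤ s → s ≤ m → σ s ∈ Igens t
  σ∈Igens s t≤s s≤m = ∈.∈-++⁺ˡ (≡.subst (λ s → σ s ∈ List.map (λ i → σ (t ℕ.+ i)) (upTo (suc m ℕ.∸ t)))
                                          (ℕP.m+[n∸m]≡n t≤s)
                                          (∈.∈-map⁺ (λ i → σ (t ℕ.+ i)) (∈.∈-upTo⁺ (ℕP.∸-monoˡ-< (s≤s s≤m) t≤s))))

  e : Fin m → Poly
  e j = 1P +P (-P y j (suc q∸2))

  e+y^[q-1]≋1 : ∀ j → (e j +P y j (suc q∸2)) ≋ 1P
  e+y^[q-1]≋1 j = begin
    (1P +P (-P y j (suc q∸2))) +P y j (suc q∸2) ≈⟨ R.+-assoc 1P (-P y j (suc q∸2)) (y j (suc q∸2)) ⟩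
    1P +P ((-P y j (suc q∸2)) +P y j (suc q∸2)) ≈⟨ R.+-congˡ {1P} (R.-‿inverseˡ (y j (suc q∸2))) ⟩
    1P +P 0P                                    ≈⟨ R.+-identityʳ 1P ⟩
    1P                                          ∎

  y·e∈I : ∀ j → (y j 1 *P e j) ∈I
  y·e∈I j = ∈I-resp (begin
    -P (y j q +P (-P y j 1))               ≈⟨ R.sym (-P‿+-comm (y j q) (-P y j 1)) ⟩
    (-P y j q) +P (-P (-P y j 1))          ≈⟨ R.+-cong (R.-‿cong y^q≋y·y^[q-1]) (-P‿involutive (y j 1)) ⟩
    (-P (y j 1 *P y j (suc q∸2))) +P y j 1 ≈⟨ R.+-comm (-P (y j 1 *P y j (suc q∸2))) (y j 1) ⟩
    y j 1 +P (-P (y j 1 *P y j (suc q∸2))) ≈⟨ R.+-cong (R.sym (R.*-identityʳ (y j 1))) (-P‿distribʳ-* (y j 1) (y j (suc q∸2))) ⟩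
    (y j 1 *P 1P) +P (y j 1 *P (-P y j (suc q∸2))) ≈⟨ R.sym (R.distribˡ (y j 1) 1P (-P y j (suc q∸2))) ⟩
    y j 1 *P e j                           ∎) (∈I-neg (∈I-gen (fieldEq∈Igens j)))
    where
    y^q≋y·y^[q-1] : y j q ≋ (y j 1 *P y j (suc q∸2))
    y^q≋y·y^[q-1] = R.sym (R.trans (mono-* (varPow j 1) (varPow j (suc q∸2)))
                                   (R.reflexive (≡.cong mono (≡.trans (varPow-+ j 1 _) (≡.cong (varPow j) (≡.sym size≡2+q∸2))))))

  eProd : List (Fin m) → Poly
  eProd []      = 1P
  eProd (j ∷ T) = e j *P eProd T

  eProd-factor : ∀ {j T} → j ∈ T → Σ Poly λ Q → eProd T ≋ (e j *P Q)
  eProd-factor {T = _ ∷ T} (here ≡.refl) = eProd T , R.refl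
  eProd-factor {j} {k ∷ T} (there j∈T) =
    let Q , eProd≋ = eProd-factor j∈T in
    (e k *P Q) , R.trans (R.*-congˡ {e k} eProd≋) (x∙yz≈y∙xz (e k) (e j) Q)

  monoSum-∈I : ∀ P Us → (∀ {U} → U ∈ Us → (mono U *P P) ∈I) → (monoSum Us *P P) ∈I
  monoSum-∈I P []       _     = ∈I-resp (R.sym (R.zeroˡ P)) ∈I-zero
  monoSum-∈I P (U ∷ Us) terms∈ = ∈I-resp (R.sym (R.distribʳ P (mono U) (monoSum Us)))
    (∈I-+ (terms∈ (here ≡.refl)) (monoSum-∈I P Us (λ U∈ → terms∈ (there U∈))))

  monoSum-isolate : ∀ P S Us → Unique Us → S ∈ Us → (∀ {U} → U ∈ Us → U ≢ S → (mono U *P P) ∈I) →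
                    (monoSum Us *P P) ∈I → (mono S *P P) ∈I
  monoSum-isolate P S (.S ∷ Us) (S∉Us ∷ _) (here ≡.refl) others∈ sum∈ =
    ∈I-cancel (∈I-resp (R.distribʳ P (mono S) (monoSum Us)) sum∈)
              (monoSum-∈I P Us (λ U∈ → others∈ (there U∈) (λ U≡S → All.lookup S∉Us U∈ (≡.sym U≡S))))
  monoSum-isolate P S (U ∷ Us) (U∉Us ∷ uniq) (there S∈Us) others∈ sum∈ =
    monoSum-isolate P S Us uniq S∈Us (λ U∈ → others∈ (there U∈))
      (∈I-cancel (∈I-resp (R.trans (R.distribʳ P (mono U) (monoSum Us)) (R.+-comm (mono U *P P) (monoSum Us *P P))) sum∈)
                 (others∈ (here ≡.refl) (λ U≡S → All.lookup U∉Us S∈Us U≡S)))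

  -- If y_j divides y^U and e_j divides P, then y^U P is a multiple of y_j e_j ∈ I.
  y·e-multiple∈I : ∀ U j P Q → lookup U j ≡ 1 → P ≋ (e j *P Q) → (mono U *P P) ∈I
  y·e-multiple∈I U j P Q Uj≡1 P≋ = ∈I-resp (R.sym (begin
    mono U *P P                      ≈⟨ R.*-cong U≋ P≋ ⟩
    (y j 1 *P mono U′) *P (e j *P Q) ≈⟨ interchange (y j 1) (mono U′) (e j) Q ⟩
    (y j 1 *P e j) *P (mono U′ *P Q) ≈⟨ R.*-comm (y j 1 *P e j) (mono U′ *P Q) ⟩
    (mono U′ *P Q) *P (y j 1 *P e j) ∎)) (∈I-* (mono U′ *P Q) (y·e∈I j))
    where
    U′ = U [ j ]≔ 0
    U≋ : mono U ≋ (y j 1 *P mono U′)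
    U≋ = R.trans (R.reflexive (≡.cong mono (varPow-factor U j Uj≡1))) (R.sym (mono-* (varPow j 1) U′))

  -- Then y^S · Π_T e_j ∈ I, because σ_{deg S} · Π_T e_j ∈ I, while any
  -- other square-free U of the same degree contains a variable y_j with
  -- j ∈ T, so that y^U · Π_T e_j is a multiple of y_j e_j.
  sqfree·eProd∈I : ∀ T S → SquareFree S → t ≤ suppSize S → (∀ j → lookup S j ≡ 0 → j ∈ T) →
                   (mono S *P eProd T) ∈I
  sqfree·eProd∈I T S sfS t≤S absent∈T =
    monoSum-isolate P S (sqfree m s) (sqfree-unique m s) (SquareFree⇒∈sqfree sfS) others∈ σ·P∈
    where
    s = suppSize S
    P = eProd T
    σ·P∈ : (monoSum (sqfree m s) *P P) ∈I
    σ·P∈ = ∈I-resp (R.*-comm P (σ s)) (∈I-* P (∈I-gen (σ∈Igens s t≤S (suppSize≤ S))))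
    others∈ : ∀ {U} → U ∈ sqfree m s → U ≢ S → (mono U *P P) ∈I
    others∈ {U} U∈ U≢S with ∈sqfree⇒SquareFree m s U∈
    ... | sfU , degU with distinguishingVar sfS sfU (ℕP.≤-reflexive (≡.sym degU)) U≢S
    ...   | j , Sj≡0 , Uj≡1 with eProd-factor (absent∈T j Sj≡0)
    ...     | Q , P≋ = y·e-multiple∈I U j P Q Uj≡1 P≋

  -- Expanding with  e_j + y_j^(q-1) = 1  at a variable y_j absent from S:
  --   y^S P = y^S e_j P + y_j^(q-2) · y^(S + e_j) P.
  expand-at : ∀ S j P → lookup S j ≡ 0 →
              (mono S *P P) ≋ ((mono S *P (e j *P P)) +P (y j q∸2 *P (mono (S [ j ]≔ 1) *P P)))
  expand-at S j P Sj≡0 = begin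
    X                                                  ≈⟨ R.sym (R.*-identityʳ X) ⟩
    X *P 1P                                            ≈⟨ R.*-congˡ {X} (R.sym (e+y^[q-1]≋1 j)) ⟩
    X *P (e j +P y j (suc q∸2))                        ≈⟨ R.distribˡ X (e j) (y j (suc q∸2)) ⟩
    (X *P e j) +P (X *P y j (suc q∸2))                 ≈⟨ R.+-cong (xy∙z≈x∙zy (mono S) P (e j)) shift ⟩
    (mono S *P (e j *P P)) +P (y j q∸2 *P (mono S′ *P P)) ∎
    where
    X = mono S *P P
    S′ = S [ j ]≔ 1
    shift : (X *P y j (suc q∸2)) ≋ (y j q∸2 *P (mono S′ *P P))
    shift = begin
      (mono S *P P) *P y j (suc q∸2)       ≈⟨ xy∙z≈xz∙y (mono S) P (y j (suc q∸2)) ⟩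
      (mono S *P y j (suc q∸2)) *P P       ≈⟨ R.*-congʳ {P} (mono-* S (varPow j (suc q∸2))) ⟩
      mono (S ·ₘ varPow j (suc q∸2)) *P P  ≈⟨ R.reflexive (≡.cong (λ α → mono α *P P) (shift-varPow S j q∸2 Sj≡0)) ⟩
      mono (S′ ·ₘ varPow j q∸2) *P P       ≈⟨ R.*-congʳ {P} (R.sym (mono-* S′ (varPow j q∸2))) ⟩
      (mono S′ *P y j q∸2) *P P            ≈⟨ xy∙z≈y∙xz (mono S′) (y j q∸2) P ⟩
      y j q∸2 *P (mono S′ *P P)            ∎

  -- Every variable absent from S is listed in T (its e_j already multiplied
  -- in) or in W (still to be treated).
  Covered : List (Fin m) → List (Fin m) → Monomial m → Set
  Covered T W S = ∀ j → lookup S j ≡ 0 → j ∈ T ⊎ j ∈ W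

  sqfree·eProd∈I′ : ∀ W T S → SquareFree S → t ≤ suppSize S → Covered T W S → (mono S *P eProd T) ∈I
  sqfree·eProd∈I′ [] T S sfS t≤S covered = sqfree·eProd∈I T S sfS t≤S absent∈T
    where
    absent∈T : ∀ j → lookup S j ≡ 0 → j ∈ T
    absent∈T j Sj≡0 with covered j Sj≡0
    ... | inj₁ j∈T = j∈T
  sqfree·eProd∈I′ (j ∷ W) T S sfS t≤S covered with lookup S j ℕP.≟ 0
  ... | no Sj≢0 = sqfree·eProd∈I′ W T S sfS t≤S covered′
    where
    covered′ : Covered T W S
    covered′ i Si≡0 with covered i Si≡0
    ... | inj₁ i∈T          = inj₁ i∈T
    ... | inj₂ (here ≡.refl) = ⊥-elim (Sj≢0 Si≡0)
    ... | inj₂ (there i∈W)  = inj₂ i∈W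
  ... | yes Sj≡0 = ∈I-resp (R.sym (expand-at S j (eProd T) Sj≡0))
                          (∈I-+ with-e∈ (∈I-* (y j q∸2) adjoined∈))
    where
    with-e-covered : Covered (j ∷ T) W S
    with-e-covered i Si≡0 with covered i Si≡0
    ... | inj₁ i∈T          = inj₁ (there i∈T)
    ... | inj₂ (here ≡.refl) = inj₁ (here ≡.refl)
    ... | inj₂ (there i∈W)  = inj₂ i∈W
    with-e∈ : (mono S *P eProd (j ∷ T)) ∈I
    with-e∈ = sqfree·eProd∈I′ W (j ∷ T) S sfS t≤S with-e-covered
    adjoined-covered : Covered T W (S [ j ]≔ 1)
    adjoined-covered i S′i≡0 with adjoin-zero S j i S′i≡0
    ... | Si≡0 , i≢j with covered i Si≡0
    ...   | inj₁ i∈T          = inj₁ i∈T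
    ...   | inj₂ (here i≡j)   = ⊥-elim (i≢j i≡j)
    ...   | inj₂ (there i∈W)  = inj₂ i∈W
    adjoined∈ : (mono (S [ j ]≔ 1) *P eProd T) ∈I
    adjoined∈ = sqfree·eProd∈I′ W T (S [ j ]≔ 1) (SquareFree-adjoin j sfS)
                  (≡.subst (t ≤_) (≡.sym (suppSize-adjoin S j Sj≡0)) (ℕP.m≤n⇒m≤1+n t≤S)) adjoined-covered

  sqfree∈I : ∀ S → SquareFree S → t ≤ suppSize S → mono S ∈I
  sqfree∈I S sfS t≤S = ∈I-resp (R.*-identityʳ (mono S))
    (sqfree·eProd∈I′ (allFin m) [] S sfS t≤S (λ j _ → inj₂ (∈.∈-allFin j)))

-- For α with fewer than t variables, pairing with
-- w_α(β) = [β reduces to α modulo y_j^q = y_j] vanishes on I_{m,t}; if moreover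
-- all exponents of α are below q, it returns the coefficient at α of any f
-- with leading monomial α.  Hence such α are not leading monomials of I_{m,t}.
module SeparatingFunctional {c ℓ} (F : FiniteField c ℓ) (m t : ℕ) where
  open FiniteField F
  open Polynomials F m
  open Specific F m
  open PolynomialAlgebra F m
  open Generators F m t using (fieldEq)
  open FieldFacts F using (_≟F_; q∸2; size≡2+q∸2)
  open ExponentReduction q∸2
  open import Data.Nat using (_<_)
  open import Relation.Binary.Reasoning.Setoid setoid

  weight : Mon → Mon → Carrier
  weight α β = δ α (reduceₘ β)

  module _ (α : Mon) (few : suppSize α < t) where

    -- The shifted weights  γ ↦ w_α(β γ)  kill every generator.  On σ_r
    -- (r ≥ t): each y^β y^U involves at least r variables, more than α.
    kills-σ : ∀ r → t ≤ r → ∀ β → pair (λ γ → weight α (β ·ₘ γ)) (σ r) ≈ 0#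
    kills-σ r t≤r β = pair-monoSum-zero _ (sqfree m r) λ {U} U∈ →
      δ-≢ {α} {reduceₘ (β ·ₘ U)} λ reduces-to-α →
        ℕP.<⇒≱ few (≡.subst (t ≤_) (≡.cong suppSize reduces-to-α) (t≤reduced U∈))
      where
      t≤reduced : ∀ {U} → U ∈ sqfree m r → t ≤ suppSize (reduceₘ (β ·ₘ U))
      t≤reduced {U} U∈ = ℕP.≤-trans t≤r (ℕP.≤-trans (ℕP.≤-reflexive (≡.sym (proj₂ (∈sqfree⇒SquareFree m r U∈))))
                                                    (suppSize-reduceₘ-factor β U))

    -- On y_j^q - y_j: the monomials y^β y_j^q and y^β y_j have the same reduction.
    kills-fieldEq : ∀ j β → pair (λ γ → weight α (β ·ₘ γ)) (fieldEq j) ≈ 0#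
    kills-fieldEq j β = begin
      1# * wq + (- 1# * w1 + 0#) ≈⟨ +-cong (*-identityˡ wq) (trans (+-identityʳ _) (-1*x≈-x w1)) ⟩
      wq + - w1                  ≈⟨ +-congˡ (-‿cong (reflexive (≡.cong (δ α) (≡.sym same-reduction)))) ⟩
      wq + - wq                  ≈⟨ -‿inverseʳ wq ⟩
      0#                         ∎
      where
      open import Algebra.Properties.Ring ring using (-1*x≈-x)
      wq = weight α (β ·ₘ varPow j size)
      w1 = weight α (β ·ₘ varPow j 1)
      same-reduction : reduceₘ (β ·ₘ varPow j size) ≡ reduceₘ (β ·ₘ varPow j 1)
      same-reduction = ≡.trans (≡.cong (λ e → reduceₘ (β ·ₘ varPow j e)) size≡2+q∸2) (reduceₘ-varPow β j)

    kills-multiples : ∀ g → g ∈ Igens t → ∀ h → pair (weight α) (h *P g) ≈ 0#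
    kills-multiples g g∈ h = trans (pair-* (weight α) h g) (pair-zeroʷ kills h)
      where
      kills : ∀ β → pair (λ γ → weight α (β ·ₘ γ)) g ≈ 0#
      kills β with ∈.∈-++⁻ (List.map (λ i → σ (t ℕ.+ i)) (upTo (suc m ℕ.∸ t))) g∈
      ... | inj₁ g∈σs with ∈.∈-map⁻ (λ i → σ (t ℕ.+ i)) g∈σs
      ...   | i , _ , ≡.refl = kills-σ (t ℕ.+ i) (ℕP.m≤m+n t i) β
      kills β | inj₂ g∈Eq with ∈.∈-map⁻ fieldEq g∈Eq
      ...   | j , _ , ≡.refl = kills-fieldEq j β

    kills-ideal : ∀ f → InIdeal (Igens t) f → pair (weight α) f ≈ 0#
    kills-ideal f (h , f≈) = trans (pair-cong (weight α) f (sumFin multiple) f≈)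
      (pair-sumFin-zero (weight α) multiple (λ i → kills-multiples _ (∈.∈-lookup i) (h i)))
      where
      multiple : Fin (List.length (Igens t)) → Poly
      multiple i = h i *P List.lookup (Igens t) i

  module _ (ord : TermOrder m) where
    open TermOrderFacts ord

    -- On f with leading monomial α (all exponents < q), w_α reads off the
    -- leading coefficient: every other y^β in f has β < α, and its
    -- reduction divides β, so it cannot be α.
    pair-weight-LM : ∀ f α → (∀ j → lookup α j < size) → IsLM ord f α → pair (weight α) f ≈ coeff f α
    pair-weight-LM f α small (_ , below-α) = begin
      pair (weight α) f                                          ≈⟨ pair-removeTerms (weight α) α f ⟩
      coeff f α * weight α α + pair (weight α) (removeTerms α f)  ≈⟨ +-cong (*-congˡ w[α]≈1) rest≈0 ⟩
      coeff f α * 1# + 0#                                        ≈⟨ trans (+-identityʳ _) (*-identityʳ _) ⟩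
      coeff f α                                                  ∎
      where
      small′ : ∀ j → lookup α j < suc (suc q∸2)
      small′ j = ≡.subst (lookup α j <_) size≡2+q∸2 (small j)
      w[α]≈1 : weight α α ≈ 1#
      w[α]≈1 = δ-≡ (reduceₘ-small α small′)
      null : ∀ β → coeff (removeTerms α f) β ≈ 0# ⊎ weight α β ≈ 0#
      null β with ≡-dec ℕP._≟_ β α
      ... | yes ≡.refl = inj₁ (coeff-removeTerms-≡ α f)
      ... | no  β≢α with coeff f β ≟F 0#
      ...   | yes fβ≈0 = inj₁ (trans (coeff-removeTerms-≢ α β β≢α f) fβ≈0)
      ...   | no  β∈f with below-α β β∈f
      ...     | inj₁ β≡α = ⊥-elim (β≢α β≡α)
      ...     | inj₂ β<α = inj₂ (δ-≢ λ red≡α →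
                    asym β<α (∣ₘ⇒< (≡.subst (_∣ₘ β) red≡α (reduceₘ-∣ₘ β)) (λ α≡β → β≢α (≡.sym α≡β))))
      rest≈0 : pair (weight α) (removeTerms α f) ≈ 0#
      rest≈0 = pair-vanishes (weight α) (removeTerms α f) null

    leading-monomials : ∀ f → InIdeal (Igens t) f → ∀ α → IsLM ord f α →
                        (Σ (Fin m) λ j → size ≤ lookup α j) ⊎ t ≤ suppSize α
    leading-monomials f f∈ α lm with any? (λ j → size ≤? lookup α j)
    ... | yes large = inj₁ large
    ... | no  none with t ≤? suppSize α
    ...   | yes t≤α = inj₂ t≤α
    ...   | no  t≰α = ⊥-elim (proj₁ lm (begin
      coeff f α          ≈⟨ sym (pair-weight-LM f α small lm) ⟩
      pair (weight α) f  ≈⟨ kills-ideal α (ℕP.≰⇒> t≰α) f f∈ ⟩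
      0#                 ∎))
      where
      small : ∀ j → lookup α j < size
      small j = ℕP.≰⇒> (λ size≤ → none (j , size≤))

module ReducedBasis {c ℓ} (F : FiniteField c ℓ) (m t : ℕ) (ord : TermOrder m) where
  open FiniteField F
  open Polynomials F m
  open Specific F m
  open PolynomialAlgebra F m
  open Ideal (Igens t) using (∈I⇒InIdeal; ∈I-gen)
  open Generators F m t
  open SeparatingFunctional F m t
  open LeadingMonomials F m ord
  open TermOrderFacts ord
  open FieldFacts F using (2≤size)

  1≤q : 1 ≤ q
  1≤q = ℕP.≤-trans (s≤s z≤n) 2≤size

  var≢y^q : ∀ (j : Fin m) → varPow j 1 ≢ varPow j q
  var≢y^q j y≡y^q = ℕP.<⇒≢ 2≤size
    (≡.trans (≡.sym (lookup-varPow j 1)) (≡.trans (≡.cong (λ α → lookup α j) y≡y^q) (lookup-varPow j q)))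

  support-fieldEq : ∀ j α → InSupport (fieldEq j) α → α ≡ varPow j q ⊎ α ≡ varPow j 1
  support-fieldEq j α α∈ with ≡-dec ℕP._≟_ (varPow j q) α
  ... | yes y^q≡α = inj₁ (≡.sym y^q≡α)
  ... | no  _ with ≡-dec ℕP._≟_ (varPow j 1) α
  ...   | yes y≡α = inj₂ (≡.sym y≡α)
  ...   | no  _   = contradiction refl α∈

  coeff-fieldEq : ∀ j → coeff (fieldEq j) (varPow j q) ≈ 1#
  coeff-fieldEq j = trans (coeff-∷-≡ 1# (varPow j q) _)
    (trans (+-congˡ (coeff-∷-≢ (- 1#) (varPow j 1) [] (varPow j q) (var≢y^q j))) (+-identityʳ 1#))

  LM-fieldEq : ∀ j → IsLM ord (fieldEq j) (varPow j q)
  LM-fieldEq j = (λ c≈0 → 0≉1 (trans (sym c≈0) (coeff-fieldEq j))) , below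
    where
    below : ∀ β → InSupport (fieldEq j) β → β ≡ varPow j q ⊎ TermOrder._<_ ord β (varPow j q)
    below β β∈ with support-fieldEq j β β∈
    ... | inj₁ β≡y^q   = inj₁ β≡y^q
    ... | inj₂ ≡.refl  = inj₂ (∣ₘ⇒< (varPow-∣ₘ (varPow j q) j 1 (≡.subst (1 ≤_) (≡.sym (lookup-varPow j q)) 1≤q))
                                     (var≢y^q j))

  module _ (2≤t : 2 ≤ t) where

    G : List Poly
    G = Eq ++ M t

    data Member : Poly → Set c where
      fieldEqᵐ : ∀ j → Member (fieldEq j)
      sqfreeᵐ  : ∀ S → S ∈ sqfree m t → Member (mono S)

    member : ∀ {g} → g ∈ G → Member g
    member g∈ with ∈.∈-++⁻ Eq g∈
    ... | inj₁ g∈Eq with ∈.∈-map⁻ fieldEq g∈Eq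
    ...   | j , _ , ≡.refl = fieldEqᵐ j
    member g∈ | inj₂ g∈M with ∈.∈-map⁻ mono g∈M
    ...   | S , S∈ , ≡.refl = sqfreeᵐ S S∈

    LM-of : ∀ {g} → Member g → Monomial m
    LM-of (fieldEqᵐ j)  = varPow j q
    LM-of (sqfreeᵐ S _) = S

    LM-member : ∀ {g} (k : Member g) → IsLM ord g (LM-of k)
    LM-member (fieldEqᵐ j)  = LM-fieldEq j
    LM-member (sqfreeᵐ S _) = LM-mono S

    monic-member : ∀ {g} (k : Member g) → coeff g (LM-of k) ≈ 1#
    monic-member (fieldEqᵐ j)  = coeff-fieldEq j
    monic-member (sqfreeᵐ S _) = coeff-mono S

    inIdeal-member : ∀ {g} → Member g → InIdeal (Igens t) g
    inIdeal-member (fieldEqᵐ j)   = ∈I⇒InIdeal (∈I-gen (fieldEq∈Igens j))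
    inIdeal-member (sqfreeᵐ S S∈) = let sf , deg = ∈sqfree⇒SquareFree m t S∈ in
      ∈I⇒InIdeal (sqfree∈I S sf (ℕP.≤-reflexive (≡.sym deg)))

    -- No term of a member is divisible by the leading monomial of another:
    -- y_j^q divides neither y_i^q, y_i (i ≠ j) nor a square-free monomial,
    -- and a square-free monomial of degree t ≥ 2 divides neither y_i^q, y_i,
    -- nor another square-free monomial of degree t.
    reduced-pair : ∀ {g g′ α} (k : Member g) (k′ : Member g′) → InSupport g α → LM-of k′ ∣ₘ α → g ≡ g′
    reduced-pair {α = α} (fieldEqᵐ i) (fieldEqᵐ j) α∈ y^q∣α with support-fieldEq i α α∈
    ... | inj₁ ≡.refl = ≡.cong fieldEq (≡.sym (varPow-∣ₘ-varPow j i q q 1≤q y^q∣α))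
    ... | inj₂ ≡.refl = ≡.cong fieldEq (≡.sym (varPow-∣ₘ-varPow j i q 1 1≤q y^q∣α))
    reduced-pair {α = α} (fieldEqᵐ i) (sqfreeᵐ S S∈) α∈ S∣α = contradiction
      (ℕP.≤-trans 2≤t (ℕP.≤-trans (ℕP.≤-reflexive (≡.sym (proj₂ (∈sqfree⇒SquareFree m t S∈))))
                                   (ℕP.≤-trans (suppSize-mono S∣α) (suppSize≤1 (support-fieldEq i α α∈)))))
      (ℕP.<⇒≱ ℕP.≤-refl)
      where
      suppSize≤1 : α ≡ varPow i q ⊎ α ≡ varPow i 1 → suppSize α ≤ 1
      suppSize≤1 (inj₁ ≡.refl) = suppSize-varPow i q
      suppSize≤1 (inj₂ ≡.refl) = suppSize-varPow i 1
    reduced-pair {α = α} (sqfreeᵐ U U∈) (fieldEqᵐ j) α∈ y^q∣α with support-mono U α α∈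
    ... | ≡.refl = contradiction
      (ℕP.≤-trans (ℕP.≤-reflexive (≡.sym (lookup-varPow j q)))
        (ℕP.≤-trans (Pointwise.lookup y^q∣α j) (SquareFree-entry≤1 (proj₁ (∈sqfree⇒SquareFree m t U∈)) j)))
      (ℕP.<⇒≱ 2≤size)
    reduced-pair {α = α} (sqfreeᵐ U U∈) (sqfreeᵐ S S∈) α∈ S∣α with support-mono U α α∈
    ... | ≡.refl = ≡.cong mono (≡.sym (SquareFree-∣ₘ⇒≡ (proj₁ sfS) (proj₁ sfU) S∣α
                                         (≡.trans (proj₂ sfS) (≡.sym (proj₂ sfU)))))
      where
      sfS = ∈sqfree⇒SquareFree m t S∈
      sfU = ∈sqfree⇒SquareFree m t U∈

    distinct : Unique G
    distinct = Unique.++⁺ (Unique.map⁺ fieldEq-injective (Unique.allFin⁺ m))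
                          (Unique.map⁺ mono-injective (sqfree-unique m t))
                          disjoint
      where
      fieldEq-injective : ∀ {i j} → fieldEq i ≡ fieldEq j → i ≡ j
      fieldEq-injective {i} {j} e = varPow-injective i j q 1≤q (≡.cong proj₂ (ListP.∷-injectiveˡ e))
      mono-injective : ∀ {S U} → mono S ≡ mono U → S ≡ U
      mono-injective e = ≡.cong proj₂ (ListP.∷-injectiveˡ e)
      disjoint : ∀ {g} → g ∈ Eq × g ∈ M t → ⊥
      disjoint (g∈Eq , g∈M) with ∈.∈-map⁻ fieldEq g∈Eq | ∈.∈-map⁻ mono g∈M
      ... | _ , _ , ≡.refl | _ , _ , ()

    criteria-Eq∪M : ReducedGBCriteria (Igens t) G
    criteria-Eq∪M = record
      { distinct     = distinct
      ; inIdeal      = λ g∈ → inIdeal-member (member g∈)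
      ; monicLM      = λ g∈ → LM-of (member g∈) , LM-member (member g∈) , monic-member (member g∈)
      ; leading      = leading
      ; interreduced = λ {_} {g′} g∈ g′∈ α∈ lm β∣α → reduced-pair (member g∈) (member g′∈) α∈
                         (≡.subst (_∣ₘ _) (LM-unique {g′} lm (LM-member (member g′∈))) β∣α)
      }
      where
      -- a leading monomial of I has a large exponent (divisible by some y_j^q)
      -- or at least t variables (divisible by a square-free monomial of degree t)
      leading : ∀ f → InIdeal (Igens t) f → ∀ α → IsLM ord f α →
                Σ Poly λ g → g ∈ G × Σ (Monomial m) λ β → IsLM ord g β × β ∣ₘ α
      leading f f∈ α lm with leading-monomials ord f f∈ α lm
      ... | inj₁ (j , q≤αj) = fieldEq j , ∈.∈-++⁺ˡ (∈.∈-map⁺ fieldEq (∈.∈-allFin j)) ,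
                              varPow j q , LM-fieldEq j , varPow-∣ₘ α j q q≤αj
      ... | inj₂ t≤α = let S , S∈ , S∣α = sqfree-divisor α t t≤α in
                       mono S , ∈.∈-++⁺ʳ Eq (∈.∈-map⁺ mono S∈) , S , LM-mono S , S∣α

  module _ (t≡1 : t ≡ 1) where

    var∈Vars : ∀ j → var j ∈ Vars
    var∈Vars j = ∈.∈-map⁺ var (∈.∈-allFin j)

    criteria-Vars : ReducedGBCriteria (Igens t) Vars
    criteria-Vars = record
      { distinct     = Unique.map⁺ var-injective (Unique.allFin⁺ m)
      ; inIdeal      = inIdeal
      ; monicLM      = monicLM
      ; leading      = leading
      ; interreduced = interreduced
      }
      where
      var-injective : ∀ {i j} → var i ≡ var j → i ≡ j
      var-injective {i} {j} e = varPow-injective i j 1 ℕP.≤-refl (≡.cong proj₂ (ListP.∷-injectiveˡ e))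
      -- by (1), as y_j is square-free of degree 1 = t
      inIdeal : ∀ {g} → g ∈ Vars → InIdeal (Igens t) g
      inIdeal g∈ with ∈.∈-map⁻ var g∈
      ... | j , _ , ≡.refl = ∈I⇒InIdeal (sqfree∈I (varPow j 1) (SquareFree-var j)
                                          (ℕP.≤-reflexive (≡.trans t≡1 (≡.sym (suppSize-var j)))))
      monicLM : ∀ {g} → g ∈ Vars → Σ (Monomial m) λ β → IsLM ord g β × coeff g β ≈ 1#
      monicLM g∈ with ∈.∈-map⁻ var g∈
      ... | j , _ , ≡.refl = varPow j 1 , LM-mono (varPow j 1) , coeff-mono (varPow j 1)
      leading : ∀ f → InIdeal (Igens t) f → ∀ α → IsLM ord f α →
                Σ Poly λ g → g ∈ Vars × Σ (Monomial m) λ β → IsLM ord g β × β ∣ₘ α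
      leading f f∈ α lm with leading-monomials ord f f∈ α lm
      ... | inj₁ (j , q≤αj) = var j , var∈Vars j , varPow j 1 , LM-mono (varPow j 1) ,
                              varPow-∣ₘ α j 1 (ℕP.≤-trans 1≤q q≤αj)
      ... | inj₂ t≤α = let j , 1≤αj = positiveEntry α (≡.subst (_≤ suppSize α) t≡1 t≤α) in
                       var j , var∈Vars j , varPow j 1 , LM-mono (varPow j 1) , varPow-∣ₘ α j 1 1≤αj
      interreduced : ∀ {g g′ α β} → g ∈ Vars → g′ ∈ Vars → InSupport g α → IsLM ord g′ β → β ∣ₘ α → g ≡ g′
      interreduced {α = α} g∈ g′∈ α∈ lm β∣α with ∈.∈-map⁻ var g∈ | ∈.∈-map⁻ var g′∈
      ... | i , _ , ≡.refl | j , _ , ≡.refl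
        with support-mono (varPow i 1) α α∈ | LM-unique {var j} lm (LM-mono (varPow j 1))
      ...   | ≡.refl | ≡.refl = ≡.cong var (≡.sym (varPow-∣ₘ-varPow j i 1 1 ℕP.≤-refl β∣α))

mainTheorem2 : ∀ {c ℓ : Level} (F : FiniteField c ℓ) (m t : ℕ) → 1 ≤ m → 1 ≤ t → t ≤ m →
    (ord : TermOrder m) →
    (2 ≤ t → Polynomials.IsReducedGB F m ord (Specific.Igens F m t) (Specific.Eq F m ++ Specific.M F m t))
    × (t ≡ 1 → Polynomials.IsReducedGB F m ord (Specific.Igens F m t) (Specific.Vars F m))
mainTheorem2 F m t _ _ _ ord =
    (λ 2≤t → criteria⇒IsReducedGB (criteria-Eq∪M 2≤t))
  , (λ t≡1 → criteria⇒IsReducedGB (criteria-Vars t≡1))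
  where
  open LeadingMonomials F m ord using (criteria⇒IsReducedGB)
  open ReducedBasis F m t ord using (criteria-Eq∪M; criteria-Vars)
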